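{- Let $L_{n,m}(x,y)$, $n,m\ge0$, be the bivariate Laguerre polynomials defined in the context. Then, as formal power series in $s,t$, $$\sum_{n,m\ge0}L_{n,m}(x,y)\,\frac{s^n}{n!}\,\frac{t^m}{m!}=\frac{1}{1-s-t}\exp\!\left(\frac{ -sx-ty}{1-s-t}\right).$$
   Context: Bivariate Laguerre polynomials: for $n,m\ge0$, $L_{n,m}(x,y)=e^{(x+y)/2}\,D^{\,n+m}\bigl(e^{ -(x+y)/2}x^ny^m\bigr)$, where $D f(x,y)=\frac{\partial f}{\partial x}(x,y)+\frac{\partial f}{\partial y}(x,y)$; these are polynomials in $\mathbb{Z}[x,y]$ (e.g. $L_{1,0}(x,y)=1-x$, $L_{1,1}(x,y)=2-2x-2y+xy$). -}

module Defs where

open import Data.Nat as ℕ using (ℕ; zero; suc; _∸_; _!; _≟_)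
open import Data.Nat.Properties using (_!≢0)
open import Data.Integer using (+_; -[1+_])
open import Data.Rational using (ℚ; 0ℚ; 1ℚ; _+_; _*_; -_; _/_)
open import Relation.Nullary.Decidable using (does)
open import Data.Bool using (if_then_else_)
open import Function using (_∘_)

ℕ→ℚ : ℕ → ℚ
ℕ→ℚ n = + n / 1

Σ≤ : ℕ → (ℕ → ℚ) → ℚ
Σ≤ zero    f = f 0
Σ≤ (suc n) f = Σ≤ n f + f (suc n)

inv! : ℕ → ℚ
inv! k = (+ 1 / (k !)) {{k !≢0}}

-- Polynomials in x, y over ℚ, represented by their coefficient function:
-- p i j = coefficient of x^i y^j.

Poly : Set
Poly = ℕ → ℕ → ℚ

mono : ℕ → ℕ → Poly
mono n m i j = if does (i ≟ n) then (if does (j ≟ m) then 1ℚ else 0ℚ) else 0ℚ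

-- D = ∂/∂x + ∂/∂y on polynomials
Dpoly : Poly → Poly
Dpoly p i j = ℕ→ℚ (suc i) * p (suc i) j + ℕ→ℚ (suc j) * p i (suc j)

-- Functions of the form  e^{c(x+y)} · p(x,y)  with c ∈ ℚ, p ∈ ℚ[x,y].
record ExpPoly : Set where
  constructor _·e^[_]
  field
    poly   : Poly
    weight : ℚ
open ExpPoly public

-- D (e^{c(x+y)} p) = e^{c(x+y)} (2c·p + D p)   (product rule, D(c(x+y)) = 2c)
DExp : ExpPoly → ExpPoly
DExp (p ·e^[ c ]) = (λ i j → (c + c) * p i j + Dpoly p i j) ·e^[ c ]

mulExp : ℚ → ExpPoly → ExpPoly
mulExp d (p ·e^[ c ]) = p ·e^[ d + c ]

iterate : {A : Set} → ℕ → (A → A) → A → A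
iterate zero    f a = a
iterate (suc n) f a = f (iterate n f a)

½ : ℚ
½ = + 1 / 2

-- L_{n,m}(x,y) = e^{(x+y)/2} D^{n+m} ( e^{-(x+y)/2} x^n y^m )
-- (the resulting weight is 1/2 + (-1/2) = 0, so the result is the polynomial part)
L : ℕ → ℕ → Poly
L n m = poly (mulExp ½ (iterate (n ℕ.+ m) DExp (mono n m ·e^[ - ½ ])))

-- Formal power series in s, t with coefficients in ℚ[x,y]:
-- F a b i j = coefficient of s^a t^b x^i y^j.

Series : Set
Series = ℕ → ℕ → ℕ → ℕ → ℚ

_⊕_ : Series → Series → Series
(F ⊕ G) a b i j = F a b i j + G a b i j

_⊛_ : Series → Series → Series
(F ⊛ G) a b i j =
  Σ≤ a λ a₁ → Σ≤ b λ b₁ → Σ≤ i λ i₁ → Σ≤ j λ j₁ →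
    F a₁ b₁ i₁ j₁ * G (a ∸ a₁) (b ∸ b₁) (i ∸ i₁) (j ∸ j₁)

neg : Series → Series
neg F a b i j = - F a b i j

monoS : ℕ → ℕ → ℕ → ℕ → Series
monoS a b i j a' b' i' j' =
  if does (a' ≟ a) then (if does (b' ≟ b) then (if does (i' ≟ i) then
    (if does (j' ≟ j) then 1ℚ else 0ℚ) else 0ℚ) else 0ℚ) else 0ℚ

oneS sS tS xS yS : Series
oneS = monoS 0 0 0 0
sS   = monoS 1 0 0 0
tS   = monoS 0 1 0 0
xS   = monoS 0 0 1 0
yS   = monoS 0 0 0 1

_^S_ : Series → ℕ → Series
F ^S zero  = oneS
F ^S suc k = F ⊛ (F ^S k)

-- Substitution  Σ_k c_k U^k  of a series U with zero constant term (in s,t)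
-- into the one-variable power series Σ_k c_k z^k.  Since U^k has s,t-order ≥ k,
-- only k ≤ a+b contributes to the coefficient of s^a t^b.
subst : (ℕ → ℚ) → Series → Series
subst c U a b i j = Σ≤ (a ℕ.+ b) λ k → c k * (U ^S k) a b i j

geomS : Series → Series
geomS = subst (λ _ → 1ℚ)

expS : Series → Series
expS = subst inv!

lhsSeries : Series
lhsSeries n m i j = L n m i j * inv! n * inv! m

rhsSeries : Series
rhsSeries =
  geomS (sS ⊕ tS) ⊛ expS ((neg (sS ⊛ xS) ⊕ neg (tS ⊛ yS)) ⊛ geomS (sS ⊕ tS))

-- Both sides are compared coefficientwise, after multiplying the coefficient of s^a t^b x^i y^j
-- by i! j!. It vanishes unless i ≤ a and j ≤ b; otherwise, with p = a − i, q = b − j and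
-- K = i + j, both sides give (−1)^K times the coefficient of s^p t^q in (1 + s + t)^(K + p + q).
--
-- Left: conjugating D by e^(−(x+y)/2) gives L_{n,m} = (D − 1)^(n+m) (x^n y^m). On Taylor
-- coefficients D acts as the sum of the two index shifts, so the Taylor coefficient of
-- (D − 1)^k (x^n y^m) at x^i y^j is n! m! times the coefficient of s^(n−i) t^(m−j) in (−1 + s + t)^k.
--
-- Right: write W = −sx − ty and G = 1/(1 − s − t). The coefficient of x^i y^j in exp(W G) comes
-- only from (W G)^K / K!, and G W^K G^K = W^K G^(K+1). The relation (1 − s − t) G^(K+1) = G^K
-- identifies the coefficients of G^(K+1) with trinomial coefficients, and the coefficient of
-- (sx)^i (ty)^j in W^K is (−1)^K K! / (i! j!).

module Submission where

open import Level using (0ℓ)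
open import Algebra.Bundles using (CommutativeSemiring; CommutativeRing)
open import Algebra.Core using (Op₂)
open import Algebra.Structures.Biased using (isCommutativeSemiringˡ; isCommutativeMonoidˡ)
import Algebra.Construct.Pointwise as Pointwise
import Algebra.Properties.CommutativeSemigroup as CommutativeSemigroupProperties
open import Data.Nat as ℕ using (ℕ; zero; suc; _∸_; _≤_; _<_; z≤n; s≤s; _!)
import Data.Nat.Properties as ℕₚ
import Relation.Binary.PropositionalEquality as ≡
open ≡ using (_≡_; _≢_)
import Relation.Binary.Reasoning.Setoid as SetoidReasoning
open import Defs

module PowerSeries {c ℓ} (R : CommutativeSemiring c ℓ) where

  open CommutativeSemiring R
  open CommutativeSemigroupProperties +-commutativeSemigroup using (interchange)
  open SetoidReasoning setoid

  sum≤ : ℕ → (ℕ → Carrier) → Carrier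
  sum≤ zero    f = f 0
  sum≤ (suc n) f = sum≤ n f + f (suc n)

  sum≤-cong : ∀ n {f g} → (∀ k → k ≤ n → f k ≈ g k) → sum≤ n f ≈ sum≤ n g
  sum≤-cong zero    f≈g = f≈g 0 z≤n
  sum≤-cong (suc n) f≈g =
    +-cong (sum≤-cong n λ k k≤n → f≈g k (ℕₚ.m≤n⇒m≤1+n k≤n)) (f≈g (suc n) ℕₚ.≤-refl)

  sum≤-zero : ∀ n {f} → (∀ k → k ≤ n → f k ≈ 0#) → sum≤ n f ≈ 0#
  sum≤-zero n f≈0 = trans (sum≤-cong n f≈0) (all-zero n)
    where
    all-zero : ∀ n → sum≤ n (λ _ → 0#) ≈ 0#
    all-zero zero    = refl
    all-zero (suc n) = trans (+-congʳ (all-zero n)) (+-identityˡ 0#)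

  sum≤-distrib-+ : ∀ n f g → sum≤ n (λ k → f k + g k) ≈ sum≤ n f + sum≤ n g
  sum≤-distrib-+ zero    f g = refl
  sum≤-distrib-+ (suc n) f g = trans (+-congʳ (sum≤-distrib-+ n f g)) (interchange _ _ _ _)

  *-distribˡ-sum≤ : ∀ x n f → x * sum≤ n f ≈ sum≤ n (λ k → x * f k)
  *-distribˡ-sum≤ x zero    f = refl
  *-distribˡ-sum≤ x (suc n) f = trans (distribˡ x _ _) (+-congʳ (*-distribˡ-sum≤ x n f))

  *-distribʳ-sum≤ : ∀ x n f → sum≤ n f * x ≈ sum≤ n (λ k → f k * x)
  *-distribʳ-sum≤ x zero    f = refl
  *-distribʳ-sum≤ x (suc n) f = trans (distribʳ x _ _) (+-congʳ (*-distribʳ-sum≤ x n f))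

  sum≤-suc : ∀ n f → sum≤ (suc n) f ≈ f 0 + sum≤ n (λ k → f (suc k))
  sum≤-suc zero    f = refl
  sum≤-suc (suc n) f = trans (+-congʳ (sum≤-suc n f)) (+-assoc _ _ _)

  sum≤-reverse : ∀ n f → sum≤ n f ≈ sum≤ n (λ k → f (n ∸ k))
  sum≤-reverse zero    f = refl
  sum≤-reverse (suc n) f = begin
    sum≤ n f + f (suc n)                  ≈⟨ +-comm _ _ ⟩
    f (suc n) + sum≤ n f                  ≈⟨ +-congˡ (sum≤-reverse n f) ⟩
    f (suc n) + sum≤ n (λ k → f (n ∸ k))  ≈⟨ sum≤-suc n (λ k → f (suc n ∸ k)) ⟨
    sum≤ (suc n) (λ k → f (suc n ∸ k))    ∎

  sum≤-triangle : ∀ n (F : ℕ → ℕ → Carrier) →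
    sum≤ n (λ k → sum≤ k (F k)) ≈ sum≤ n (λ l → sum≤ (n ∸ l) (λ m → F (l ℕ.+ m) l))
  sum≤-triangle zero    F = refl
  sum≤-triangle (suc n) F = begin
    sum≤ n (λ k → sum≤ k (F k)) + (sum≤ n (F (suc n)) + F (suc n) (suc n))
      ≈⟨ +-congʳ (sum≤-triangle n F) ⟩
    sum≤ n (λ l → sum≤ (n ∸ l) (λ m → F (l ℕ.+ m) l)) + (sum≤ n (F (suc n)) + F (suc n) (suc n))
      ≈⟨ +-assoc _ _ _ ⟨
    sum≤ n (λ l → sum≤ (n ∸ l) (λ m → F (l ℕ.+ m) l)) + sum≤ n (F (suc n)) + F (suc n) (suc n)
      ≈⟨ +-cong (sum≤-distrib-+ n _ _) (reflexive (≡.cong (λ k → F k (suc n)) (ℕₚ.+-identityʳ (suc n)))) ⟨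
    sum≤ n (λ l → sum≤ (n ∸ l) (λ m → F (l ℕ.+ m) l) + F (suc n) l) + F (suc n ℕ.+ 0) (suc n)
      ≈⟨ +-congʳ (sum≤-cong n extend) ⟩
    sum≤ n (λ l → sum≤ (suc n ∸ l) (λ m → F (l ℕ.+ m) l)) + sum≤ 0 (λ m → F (suc n ℕ.+ m) (suc n))
      ≈⟨ +-congˡ (reflexive (≡.cong (λ r → sum≤ r (λ m → F (suc n ℕ.+ m) (suc n))) (ℕₚ.n∸n≡0 n))) ⟨
    sum≤ n (λ l → sum≤ (suc n ∸ l) (λ m → F (l ℕ.+ m) l)) + sum≤ (suc n ∸ suc n) (λ m → F (suc n ℕ.+ m) (suc n))
      ∎
    where
    extend : ∀ l → l ≤ n →
      sum≤ (n ∸ l) (λ m → F (l ℕ.+ m) l) + F (suc n) l ≈ sum≤ (suc n ∸ l) (λ m → F (l ℕ.+ m) l)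
    extend l l≤n = begin
      sum≤ (n ∸ l) (λ m → F (l ℕ.+ m) l) + F (suc n) l
        ≈⟨ +-congˡ (reflexive (≡.cong (λ k → F k l) l+[1+n∸l]≡1+n)) ⟨
      sum≤ (suc (n ∸ l)) (λ m → F (l ℕ.+ m) l)
        ≈⟨ reflexive (≡.cong (λ r → sum≤ r (λ m → F (l ℕ.+ m) l)) (ℕₚ.+-∸-assoc 1 l≤n)) ⟨
      sum≤ (suc n ∸ l) (λ m → F (l ℕ.+ m) l) ∎
      where
      l+[1+n∸l]≡1+n : l ℕ.+ suc (n ∸ l) ≡ suc n
      l+[1+n∸l]≡1+n = ≡.trans (ℕₚ.+-suc l (n ∸ l)) (≡.cong suc (ℕₚ.m+[n∸m]≡n l≤n))

  infixl 7 _⋆_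
  _⋆_ : Op₂ (ℕ → Carrier)
  (f ⋆ g) n = sum≤ n (λ k → f k * g (n ∸ k))

  unit : ℕ → Carrier
  unit zero    = 1#
  unit (suc _) = 0#

  ⋆-cong : ∀ {f f′ g g′} → (∀ n → f n ≈ f′ n) → (∀ n → g n ≈ g′ n) →
           ∀ n → (f ⋆ g) n ≈ (f′ ⋆ g′) n
  ⋆-cong f≈f′ g≈g′ n = sum≤-cong n λ k _ → *-cong (f≈f′ k) (g≈g′ (n ∸ k))

  ⋆-identityˡ : ∀ f n → (unit ⋆ f) n ≈ f n
  ⋆-identityˡ f zero    = *-identityˡ (f 0)
  ⋆-identityˡ f (suc n) = begin
    (unit ⋆ f) (suc n)                              ≈⟨ sum≤-suc n _ ⟩
    1# * f (suc n) + sum≤ n (λ k → 0# * f (n ∸ k))  ≈⟨ +-cong (*-identityˡ _) (sum≤-zero n λ k _ → zeroˡ _) ⟩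
    f (suc n) + 0#                                  ≈⟨ +-identityʳ _ ⟩
    f (suc n)                                       ∎

  ⋆-zeroˡ : ∀ f n → ((λ _ → 0#) ⋆ f) n ≈ 0#
  ⋆-zeroˡ f n = sum≤-zero n λ k _ → zeroˡ _

  ⋆-distribʳ : ∀ f g h n → ((λ m → g m + h m) ⋆ f) n ≈ (g ⋆ f) n + (h ⋆ f) n
  ⋆-distribʳ f g h n = trans (sum≤-cong n λ k _ → distribʳ _ _ _) (sum≤-distrib-+ n _ _)

  ⋆-comm : ∀ f g n → (f ⋆ g) n ≈ (g ⋆ f) n
  ⋆-comm f g n = trans (sum≤-reverse n _) (sum≤-cong n λ k k≤n →
    trans (*-comm _ _) (*-congʳ (reflexive (≡.cong g (ℕₚ.m∸[m∸n]≡n k≤n)))))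

  ⋆-assoc : ∀ f g h n → ((f ⋆ g) ⋆ h) n ≈ (f ⋆ (g ⋆ h)) n
  ⋆-assoc f g h n = begin
    sum≤ n (λ k → sum≤ k (λ l → f l * g (k ∸ l)) * h (n ∸ k))
      ≈⟨ sum≤-cong n (λ k _ → *-distribʳ-sum≤ _ k _) ⟩
    sum≤ n (λ k → sum≤ k (λ l → f l * g (k ∸ l) * h (n ∸ k)))
      ≈⟨ sum≤-triangle n (λ k l → f l * g (k ∸ l) * h (n ∸ k)) ⟩
    sum≤ n (λ l → sum≤ (n ∸ l) (λ m → f l * g (l ℕ.+ m ∸ l) * h (n ∸ (l ℕ.+ m))))
      ≈⟨ sum≤-cong n (λ l _ → sum≤-cong (n ∸ l) (λ m _ → reassociate l m)) ⟩
    sum≤ n (λ l → sum≤ (n ∸ l) (λ m → f l * (g m * h (n ∸ l ∸ m))))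
      ≈⟨ sum≤-cong n (λ l _ → *-distribˡ-sum≤ (f l) (n ∸ l) _) ⟨
    sum≤ n (λ l → f l * sum≤ (n ∸ l) (λ m → g m * h (n ∸ l ∸ m)))
      ∎
    where
    reassociate : ∀ l m → f l * g (l ℕ.+ m ∸ l) * h (n ∸ (l ℕ.+ m)) ≈ f l * (g m * h (n ∸ l ∸ m))
    reassociate l m = trans (*-assoc _ _ _) (*-congˡ (*-cong
      (reflexive (≡.cong g (ℕₚ.m+n∸m≡n l m)))
      (reflexive (≡.cong h (≡.sym (ℕₚ.∸-+-assoc n l m))))))

  commutativeSemiring : CommutativeSemiring c ℓ
  commutativeSemiring = record
    { Carrier = ℕ → Carrier
    ; _≈_     = λ f g → ∀ n → f n ≈ g n
    ; _+_     = λ f g n → f n + g n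
    ; _*_     = _⋆_
    ; 0#      = λ _ → 0#
    ; 1#      = unit
    ; isCommutativeSemiring = isCommutativeSemiringˡ record
      { +-isCommutativeMonoid = Pointwise.isCommutativeMonoid ℕ +-isCommutativeMonoid
      ; *-isCommutativeMonoid = isCommutativeMonoidˡ record
        { isSemigroup = record
          { isMagma = record
            { isEquivalence = Pointwise.isEquivalence ℕ isEquivalence
            ; ∙-cong        = ⋆-cong
            }
          ; assoc = ⋆-assoc
          }
        ; identityˡ = ⋆-identityˡ
        ; comm      = ⋆-comm
        }
      ; distribʳ = ⋆-distribʳ
      ; zeroˡ    = ⋆-zeroˡ
      }
    }

powerSeries : ∀ {c ℓ} → CommutativeSemiring c ℓ → CommutativeSemiring c ℓ
powerSeries = PowerSeries.commutativeSemiring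

sum≤-pointwise : ∀ {c ℓ} (R : CommutativeSemiring c ℓ) n (u : ℕ → ℕ → CommutativeSemiring.Carrier R) m →
                 PowerSeries.sum≤ (powerSeries R) n u m ≡ PowerSeries.sum≤ R n (λ k → u k m)
sum≤-pointwise R zero    u m = ≡.refl
sum≤-pointwise R (suc n) u m = ≡.cong (λ s → CommutativeSemiring._+_ R s (u (suc n) m)) (sum≤-pointwise R n u m)

module _ {c ℓ} (R : CommutativeSemiring c ℓ) where

  open CommutativeSemiring R
  open SetoidReasoning setoid

  withMultiplication : (_∘_ : Op₂ Carrier) (e : Carrier) → (∀ x y → (x ∘ y) ≈ x * y) → e ≈ 1# →
                       CommutativeSemiring c ℓ
  withMultiplication _∘_ e ∘≈* e≈1 = record
    { Carrier = Carrier
    ; _≈_     = _≈_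
    ; _+_     = _+_
    ; _*_     = _∘_
    ; 0#      = 0#
    ; 1#      = e
    ; isCommutativeSemiring = isCommutativeSemiringˡ record
      { +-isCommutativeMonoid = +-isCommutativeMonoid
      ; *-isCommutativeMonoid = isCommutativeMonoidˡ record
        { isSemigroup = record
          { isMagma = record { isEquivalence = isEquivalence ; ∙-cong = ∘-cong }
          ; assoc   = ∘-assoc
          }
        ; identityˡ = λ x → trans (∘≈* e x) (trans (*-congʳ e≈1) (*-identityˡ x))
        ; comm      = λ x y → trans (∘≈* x y) (trans (*-comm x y) (sym (∘≈* y x)))
        }
      ; distribʳ = λ x y z → trans (∘≈* _ x) (trans (distribʳ x y z) (sym (+-cong (∘≈* y x) (∘≈* z x))))
      ; zeroˡ    = λ x → trans (∘≈* 0# x) (zeroˡ x)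
      }
    }
    where
    ∘-cong : ∀ {x x′ y y′} → x ≈ x′ → y ≈ y′ → (x ∘ y) ≈ (x′ ∘ y′)
    ∘-cong x≈x′ y≈y′ = trans (∘≈* _ _) (trans (*-cong x≈x′ y≈y′) (sym (∘≈* _ _)))

    ∘-assoc : ∀ x y z → ((x ∘ y) ∘ z) ≈ (x ∘ (y ∘ z))
    ∘-assoc x y z = begin
      (x ∘ y) ∘ z    ≈⟨ ∘≈* _ z ⟩
      (x ∘ y) * z    ≈⟨ *-congʳ (∘≈* x y) ⟩
      (x * y) * z    ≈⟨ *-assoc x y z ⟩
      x * (y * z)    ≈⟨ *-congˡ (∘≈* y z) ⟨
      x * (y ∘ z)    ≈⟨ ∘≈* x _ ⟨
      x ∘ (y ∘ z)    ∎

open ≡ using (refl; cong; cong₂; sym; trans; module ≡-Reasoning)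
open import Data.Bool using (true; false; if_then_else_)
open import Data.Bool.Properties using (if-eta; if-float)
open import Data.Empty using (⊥-elim)
open import Data.Sum using (_⊎_; inj₁; inj₂)
import Data.Sum as Sum
open import Function using (_∘_)
open import Relation.Nullary using (¬_; yes; no; does)
open import Relation.Nullary.Decidable using (dec-true; dec-false; dec⇒maybe)
import Data.Integer as ℤ
import Data.Integer.Properties as ℤₚ
import Data.Nat.Coprimality as Coprimality
open import Data.Rational using (ℚ; 0ℚ; 1ℚ; _+_; _*_; -_; mkℚ; _/_)
import Data.Rational.Properties as ℚₚ
open import Algebra.Properties.Group ℚₚ.+-0-group using (inverseˡ-unique; ⁻¹-involutive)
import Algebra.Properties.CommutativeSemiring.Exp as SemiringExp
open import Tactic.RingSolver using (solve-∀)
open import Tactic.RingSolver.Core.AlmostCommutativeRing using (AlmostCommutativeRing; fromCommutativeRing)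

private
  ℚ-ring : AlmostCommutativeRing 0ℓ 0ℓ
  ℚ-ring = fromCommutativeRing ℚₚ.+-*-commutativeRing λ x → dec⇒maybe (0ℚ ℚₚ.≟ x)

ℕ→ℚ≡mkℚ : ∀ n → ℕ→ℚ n ≡ mkℚ (ℤ.+ n) 0 (Coprimality.sym (Coprimality.1-coprimeTo n))
ℕ→ℚ≡mkℚ n = ℚₚ.normalize-coprime _

ℕ→ℚ-+ : ∀ m n → ℕ→ℚ (m ℕ.+ n) ≡ ℕ→ℚ m + ℕ→ℚ n
ℕ→ℚ-+ m n = sym (trans (cong₂ _+_ (ℕ→ℚ≡mkℚ m) (ℕ→ℚ≡mkℚ n)) (cong (_/ 1)
  (trans (cong₂ ℤ._+_ (ℤₚ.*-identityʳ (ℤ.+ m)) (ℤₚ.*-identityʳ (ℤ.+ n))) (sym (ℤₚ.pos-+ m n)))))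

ℕ→ℚ-* : ∀ m n → ℕ→ℚ (m ℕ.* n) ≡ ℕ→ℚ m * ℕ→ℚ n
ℕ→ℚ-* m n = sym (trans (cong₂ _*_ (ℕ→ℚ≡mkℚ m) (ℕ→ℚ≡mkℚ n)) (cong (_/ 1) (sym (ℤₚ.pos-* m n))))

inv!-inverse : ∀ k → inv! k * ℕ→ℚ (k !) ≡ 1ℚ
inv!-inverse k = inverse (k !) {{k ℕₚ.!≢0}}
  where
  inverse : ∀ n .{{_ : ℕ.NonZero n}} → (ℤ.+ 1 / n) * ℕ→ℚ n ≡ 1ℚ
  inverse (suc d) = trans
    (cong₂ _*_ (ℚₚ.normalize-coprime (Coprimality.1-coprimeTo (suc d))) (ℕ→ℚ≡mkℚ (suc d)))
    (ℚₚ.*-inverseˡ (mkℚ (ℤ.+ suc d) 0 (Coprimality.sym (Coprimality.1-coprimeTo (suc d)))))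

-- for a polynomial p, the derivative ∂ₓ^i ∂ᵧ^j p at the origin
taylor : Poly → Poly
taylor p i j = p i j * (ℕ→ℚ (i !) * ℕ→ℚ (j !))

sgn : ℕ → ℚ
sgn zero    = 1ℚ
sgn (suc n) = - sgn n

sgn-+-double : ∀ n r → sgn (n ℕ.+ (r ℕ.+ r)) ≡ sgn n
sgn-+-double n zero    = cong sgn (ℕₚ.+-identityʳ n)
sgn-+-double n (suc r) = trans (cong sgn n+[1+r+1+r]≡2+n+[r+r]) (trans (⁻¹-involutive _) (sgn-+-double n r))
  where
  n+[1+r+1+r]≡2+n+[r+r] : n ℕ.+ (suc r ℕ.+ suc r) ≡ suc (suc (n ℕ.+ (r ℕ.+ r)))
  n+[1+r+1+r]≡2+n+[r+r] = trans (ℕₚ.+-suc n _) (cong suc (trans (cong (n ℕ.+_) (ℕₚ.+-suc r r)) (ℕₚ.+-suc n _)))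

ℚ⟦_⟧ : ℕ → CommutativeSemiring 0ℓ 0ℓ
ℚ⟦ zero  ⟧ = CommutativeRing.commutativeSemiring ℚₚ.+-*-commutativeRing
ℚ⟦ suc n ⟧ = powerSeries ℚ⟦ n ⟧

private
  module P₁ = PowerSeries ℚ⟦ 0 ⟧
  module P₂ = PowerSeries ℚ⟦ 1 ⟧
  module P₃ = PowerSeries ℚ⟦ 2 ⟧
  module P₄ = PowerSeries ℚ⟦ 3 ⟧

Σ≤-as-sum≤ : ∀ n f → Σ≤ n f ≡ P₁.sum≤ n f
Σ≤-as-sum≤ zero    f = refl
Σ≤-as-sum≤ (suc n) f = cong (_+ f (suc n)) (Σ≤-as-sum≤ n f)

Σ≤-cong : ∀ n {f g : ℕ → ℚ} → (∀ k → f k ≡ g k) → Σ≤ n f ≡ Σ≤ n g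
Σ≤-cong zero    f≡g = f≡g 0
Σ≤-cong (suc n) f≡g = cong₂ _+_ (Σ≤-cong n f≡g) (f≡g (suc n))

Σ≤-zero : ∀ n {f} → (∀ k → k ≤ n → f k ≡ 0ℚ) → Σ≤ n f ≡ 0ℚ
Σ≤-zero n f≡0 = trans (Σ≤-as-sum≤ n _) (P₁.sum≤-zero n f≡0)

Σ≤-distrib-+ : ∀ n f g → Σ≤ n (λ k → f k + g k) ≡ Σ≤ n f + Σ≤ n g
Σ≤-distrib-+ n f g = trans (Σ≤-as-sum≤ n _) (trans (P₁.sum≤-distrib-+ n f g)
  (sym (cong₂ _+_ (Σ≤-as-sum≤ n f) (Σ≤-as-sum≤ n g))))

*-distribˡ-Σ≤ : ∀ x n f → x * Σ≤ n f ≡ Σ≤ n (λ k → x * f k)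
*-distribˡ-Σ≤ x n f = trans (cong (x *_) (Σ≤-as-sum≤ n f)) (trans (P₁.*-distribˡ-sum≤ x n f)
  (sym (Σ≤-as-sum≤ n _)))

Σ≤-single : ∀ n m {f} → m ≤ n → (∀ k → k ≤ n → k ≢ m → f k ≡ 0ℚ) → Σ≤ n f ≡ f m
Σ≤-single zero    zero    z≤n     f≡0 = refl
Σ≤-single (suc n) m {f} m≤1+n f≡0 with m ℕₚ.≟ suc n
... | yes refl = trans
  (cong (_+ f (suc n)) (Σ≤-zero n λ k k≤n → f≡0 k (ℕₚ.m≤n⇒m≤1+n k≤n) (ℕₚ.<⇒≢ (s≤s k≤n))))
  (ℚₚ.+-identityˡ _)
... | no m≢1+n = trans
  (cong₂ _+_ (Σ≤-single n m (ℕₚ.≤-pred (ℕₚ.≤∧≢⇒< m≤1+n m≢1+n)) λ k k≤n →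
                f≡0 k (ℕₚ.m≤n⇒m≤1+n k≤n))
             (f≡0 (suc n) ℕₚ.≤-refl (m≢1+n ∘ sym)))
  (ℚₚ.+-identityʳ _)

Σ≤-suc : ∀ n f → Σ≤ (suc n) f ≡ f 0 + Σ≤ n (λ k → f (suc k))
Σ≤-suc n f = trans (Σ≤-as-sum≤ (suc n) f) (trans (P₁.sum≤-suc n f) (cong (f 0 +_) (sym (Σ≤-as-sum≤ n _))))

-- shift α a f is the coefficient of z^a in z^α · Σ f(n) z^n.
shift : ℕ → ℕ → (ℕ → ℚ) → ℚ
shift zero    a       f = f a
shift (suc α) zero    f = 0ℚ
shift (suc α) (suc a) f = shift α a f

shift-≤ : ∀ {α a} f → α ≤ a → shift α a f ≡ f (a ∸ α)
shift-≤ {zero}          f _           = refl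
shift-≤ {suc α} {suc a} f (s≤s α≤a)   = shift-≤ f α≤a

shift-≰ : ∀ {α a} f → ¬ α ≤ a → shift α a f ≡ 0ℚ
shift-≰ {zero}          f α≰a = ⊥-elim (α≰a z≤n)
shift-≰ {suc α} {zero}  f α≰a = refl
shift-≰ {suc α} {suc a} f α≰a = shift-≰ f (α≰a ∘ s≤s)

shift-cong : ∀ α a {f g} → (∀ x → f x ≡ g x) → shift α a f ≡ shift α a g
shift-cong zero    a       f≡g = f≡g a
shift-cong (suc α) zero    f≡g = refl
shift-cong (suc α) (suc a) f≡g = shift-cong α a f≡g

shift-zero : ∀ α a {f} → (∀ x → f x ≡ 0ℚ) → shift α a f ≡ 0ℚ
shift-zero zero    a       f≡0 = f≡0 a
shift-zero (suc α) zero    f≡0 = refl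
shift-zero (suc α) (suc a) f≡0 = shift-zero α a f≡0

shift-* : ∀ α a x f → shift α a (λ m → x * f m) ≡ x * shift α a f
shift-* zero    a       x f = refl
shift-* (suc α) zero    x f = sym (ℚₚ.*-zeroʳ x)
shift-* (suc α) (suc a) x f = shift-* α a x f

shift-+ : ∀ α a f → shift α (α ℕ.+ a) f ≡ f a
shift-+ zero    a f = refl
shift-+ (suc α) a f = shift-+ α a f

Σ≤-supported : ∀ α a {f g} → (∀ k → k ≢ α → f k ≡ 0ℚ) → (α ≤ a → f α ≡ g (a ∸ α)) →
               Σ≤ a f ≡ shift α a g
Σ≤-supported α a {g = g} f≡0 fα with α ℕₚ.≤? a
... | yes α≤a = trans (Σ≤-single a α α≤a λ k _ → f≡0 k) (trans (fα α≤a) (sym (shift-≤ g α≤a)))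
... | no  α≰a = trans (Σ≤-zero a λ { k k≤a → f≡0 k λ { refl → α≰a k≤a } }) (sym (shift-≰ g α≰a))

Σ≤-shift₁ : ∀ n a (u : ℕ → ℕ → ℚ) →
            Σ≤ n (λ k → shift 1 a (u k)) ≡ shift 1 a (λ a′ → Σ≤ n (λ k → u k a′))
Σ≤-shift₁ n zero    u = Σ≤-zero n λ _ _ → refl
Σ≤-shift₁ n (suc a) u = refl

indicator : ℕ → ℕ → ℚ → ℚ
indicator α k x = if does (k ℕₚ.≟ α) then x else 0ℚ

indicator-self : ∀ α x → indicator α α x ≡ x
indicator-self α x = cong (if_then x else 0ℚ) (dec-true (α ℕₚ.≟ α) refl)

indicator-other : ∀ {α k} x → k ≢ α → indicator α k x ≡ 0ℚ
indicator-other {α} {k} x k≢α = cong (if_then x else 0ℚ) (dec-false (k ℕₚ.≟ α) k≢α)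

indicator-*-other : ∀ {α k} x y → k ≢ α → indicator α k x * y ≡ 0ℚ
indicator-*-other x y k≢α = trans (cong (_* y) (indicator-other x k≢α)) (ℚₚ.*-zeroˡ y)

indicator-zero : ∀ α k → indicator α k 0ℚ ≡ 0ℚ
indicator-zero α k = if-eta (does (k ℕₚ.≟ α))

indicator-+ : ∀ α k x y → indicator α k (x + y) ≡ indicator α k x + indicator α k y
indicator-+ α k x y = distrib (does (k ℕₚ.≟ α))
  where
  distrib : ∀ b → (if b then x + y else 0ℚ) ≡ (if b then x else 0ℚ) + (if b then y else 0ℚ)
  distrib true  = refl
  distrib false = refl

indicator-neg : ∀ α k x → indicator α k (- x) ≡ - indicator α k x
indicator-neg α k x = sym (if-float -_ (does (k ℕₚ.≟ α)))

shift-indicator : ∀ α k a f → shift 1 a (λ a′ → indicator α k (f a′)) ≡ indicator α k (shift 1 a f)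
shift-indicator α k zero    f = sym (indicator-zero α k)
shift-indicator α k (suc a) f = refl

Σ≤-indicator₁ : ∀ δ c (F : ℕ → ℚ) j → Σ≤ j (λ j₁ → indicator δ j₁ c * F (j ∸ j₁)) ≡ c * shift δ j F
Σ≤-indicator₁ δ c F j = trans
  (Σ≤-supported δ j (λ k → indicator-*-other c _) λ _ → cong (_* F (j ∸ δ)) (indicator-self δ c))
  (shift-* δ j c F)

Σ≤-indicator₂ : ∀ γ δ c (F : ℕ → ℕ → ℚ) i j →
  (Σ≤ i λ i₁ → Σ≤ j λ j₁ → indicator γ i₁ (indicator δ j₁ c) * F (i ∸ i₁) (j ∸ j₁))
  ≡ c * shift γ i (λ i′ → shift δ j (F i′))
Σ≤-indicator₂ γ δ c F i j = trans
  (Σ≤-supported γ i (λ k k≢γ → Σ≤-zero j λ _ _ → indicator-*-other _ _ k≢γ) λ _ →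
    trans (Σ≤-cong j λ _ → cong (_* _) (indicator-self γ _)) (Σ≤-indicator₁ δ c (F (i ∸ γ)) j))
  (shift-* γ i c _)

Σ≤-indicator₃ : ∀ β γ δ c (F : ℕ → ℕ → ℕ → ℚ) b i j →
  (Σ≤ b λ b₁ → Σ≤ i λ i₁ → Σ≤ j λ j₁ →
     indicator β b₁ (indicator γ i₁ (indicator δ j₁ c)) * F (b ∸ b₁) (i ∸ i₁) (j ∸ j₁))
  ≡ c * shift β b (λ b′ → shift γ i λ i′ → shift δ j (F b′ i′))
Σ≤-indicator₃ β γ δ c F b i j = trans
  (Σ≤-supported β b (λ k k≢β → Σ≤-zero i λ _ _ → Σ≤-zero j λ _ _ → indicator-*-other _ _ k≢β) λ _ →
    trans (Σ≤-cong i λ _ → Σ≤-cong j λ _ → cong (_* _) (indicator-self β _))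
          (Σ≤-indicator₂ γ δ c (F (b ∸ β)) i j))
  (shift-* β b c _)

Σ≤-indicator₄ : ∀ α β γ δ c (F : Series) a b i j →
  (Σ≤ a λ a₁ → Σ≤ b λ b₁ → Σ≤ i λ i₁ → Σ≤ j λ j₁ →
     indicator α a₁ (indicator β b₁ (indicator γ i₁ (indicator δ j₁ c)))
       * F (a ∸ a₁) (b ∸ b₁) (i ∸ i₁) (j ∸ j₁))
  ≡ c * shift α a (λ a′ → shift β b λ b′ → shift γ i λ i′ → shift δ j (F a′ b′ i′))
Σ≤-indicator₄ α β γ δ c F a b i j = trans
  (Σ≤-supported α a (λ k k≢α → Σ≤-zero b λ _ _ → Σ≤-zero i λ _ _ → Σ≤-zero j λ _ _ →
                                 indicator-*-other _ _ k≢α) λ _ →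
    trans (Σ≤-cong b λ _ → Σ≤-cong i λ _ → Σ≤-cong j λ _ → cong (_* _) (indicator-self α _))
          (Σ≤-indicator₃ β γ δ c (F (a ∸ α)) b i j))
  (shift-* α a c _)

-- The commutative semiring of power series in s, t, x, y

private
  sum≤₂-eval : ∀ n u j → P₂.sum≤ n u j ≡ Σ≤ n (λ k → u k j)
  sum≤₂-eval n u j = trans (sum≤-pointwise ℚ⟦ 0 ⟧ n u j) (sym (Σ≤-as-sum≤ n _))

  sum≤₃-eval : ∀ n u i j → P₃.sum≤ n u i j ≡ Σ≤ n (λ k → u k i j)
  sum≤₃-eval n u i j = trans (cong (λ v → v j) (sum≤-pointwise ℚ⟦ 1 ⟧ n u i)) (sum≤₂-eval n _ j)

  sum≤₄-eval : ∀ n u b i j → P₄.sum≤ n u b i j ≡ Σ≤ n (λ k → u k b i j)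
  sum≤₄-eval n u b i j = trans (cong (λ v → v i j) (sum≤-pointwise ℚ⟦ 2 ⟧ n u b)) (sum≤₃-eval n _ i j)

  ⋆₂-coeff : ∀ f g i j → (f P₂.⋆ g) i j ≡ Σ≤ i λ i₁ → Σ≤ j λ j₁ → f i₁ j₁ * g (i ∸ i₁) (j ∸ j₁)
  ⋆₂-coeff f g i j = trans (sum≤₂-eval i _ j) (Σ≤-cong i λ i₁ → sym (Σ≤-as-sum≤ j _))

  ⋆₃-coeff : ∀ f g b i j → (f P₃.⋆ g) b i j ≡
             Σ≤ b λ b₁ → Σ≤ i λ i₁ → Σ≤ j λ j₁ → f b₁ i₁ j₁ * g (b ∸ b₁) (i ∸ i₁) (j ∸ j₁)
  ⋆₃-coeff f g b i j = trans (sum≤₃-eval b _ i j) (Σ≤-cong b λ b₁ → ⋆₂-coeff (f b₁) (g (b ∸ b₁)) i j)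

⊛-as-⋆ : ∀ F G a b i j → (F ⊛ G) a b i j ≡ (F P₄.⋆ G) a b i j
⊛-as-⋆ F G a b i j =
  sym (trans (sum≤₄-eval a _ b i j) (Σ≤-cong a λ a₁ → ⋆₃-coeff (F a₁) (G (a ∸ a₁)) b i j))

oneS-as-unit : ∀ a b i j → oneS a b i j ≡ CommutativeSemiring.1# ℚ⟦ 4 ⟧ a b i j
oneS-as-unit (suc a) b       i       j       = refl
oneS-as-unit zero    (suc b) i       j       = refl
oneS-as-unit zero    zero    (suc i) j       = refl
oneS-as-unit zero    zero    zero    (suc j) = refl
oneS-as-unit zero    zero    zero    zero    = refl

-- The product ⊛ is the product of ℚ⟦ 4 ⟧ written out coefficientwise, so it inherits its laws.
series : CommutativeSemiring 0ℓ 0ℓ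
series = withMultiplication ℚ⟦ 4 ⟧ _⊛_ oneS ⊛-as-⋆ oneS-as-unit

module 𝕊 where
  open CommutativeSemiring series public
  open SemiringExp series public using (_^_; ^-distrib-*)

infix 4 _≋_
_≋_ : Series → Series → Set
F ≋ G = ∀ a b i j → F a b i j ≡ G a b i j

^S-as-^ : ∀ F k → F ^S k ≡ F 𝕊.^ k
^S-as-^ F zero    = refl
^S-as-^ F (suc k) = cong (F ⊛_) (^S-as-^ F k)

^S-distrib-⊛ : ∀ F G k → (F ⊛ G) ^S k ≋ (F ^S k) ⊛ (G ^S k)
^S-distrib-⊛ F G k a b i j = trans (cong (λ X → X a b i j) (^S-as-^ (F ⊛ G) k))
  (trans (𝕊.^-distrib-* F G k a b i j)
         (sym (cong₂ (λ X Y → (X ⊛ Y) a b i j) (^S-as-^ F k) (^S-as-^ G k))))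

-- monoS α β γ δ unfolds to nested indicators.
⊛-monomial : ∀ α β γ δ F a b i j → (monoS α β γ δ ⊛ F) a b i j ≡
             shift α a λ a′ → shift β b λ b′ → shift γ i λ i′ → shift δ j (F a′ b′ i′)
⊛-monomial α β γ δ F a b i j = trans (Σ≤-indicator₄ α β γ δ 1ℚ F a b i j) (ℚₚ.*-identityˡ _)

neg-⊛ : ∀ X F → neg X ⊛ F ≋ neg (X ⊛ F)
neg-⊛ X F a b i j = inverseˡ-unique _ _ (sum≋0 a b i j)
  where
  sum≋0 : (neg X ⊛ F) ⊕ (X ⊛ F) ≋ λ _ _ _ _ → 0ℚ
  sum≋0 = 𝕊.trans (𝕊.sym (𝕊.distribʳ F (neg X) X))
         (𝕊.trans (𝕊.*-congʳ {F} {neg X ⊕ X} (λ a b i j → ℚₚ.+-inverseˡ (X a b i j))) (𝕊.zeroˡ F))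

-- the series h(s, t), free of x and y
fromST : (ℕ → ℕ → ℚ) → Series
fromST h a b i j = indicator 0 i (indicator 0 j (h a b))

-- the series φ(sx, ty)
fromSxTy : (ℕ → ℕ → ℚ) → Series
fromSxTy φ a b i j = indicator i a (indicator j b (φ i j))

⊛-fromST : ∀ X h a b i j →
  (X ⊛ fromST h) a b i j ≡ Σ≤ a λ a₁ → Σ≤ b λ b₁ → X a₁ b₁ i j * h (a ∸ a₁) (b ∸ b₁)
⊛-fromST X h a b i j = Σ≤-cong a λ a₁ → Σ≤-cong b λ b₁ → collapse (X a₁ b₁) (h (a ∸ a₁) (b ∸ b₁))
  where
  ∸≢0 : ∀ {k n} → k ≤ n → k ≢ n → n ∸ k ≢ 0
  ∸≢0 k≤n k≢n n∸k≡0 = k≢n (ℕₚ.≤-antisym k≤n (ℕₚ.m∸n≡0⇒m≤n n∸k≡0))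

  collapse : ∀ (Y : ℕ → ℕ → ℚ) c →
    (Σ≤ i λ i₁ → Σ≤ j λ j₁ → Y i₁ j₁ * indicator 0 (i ∸ i₁) (indicator 0 (j ∸ j₁) c)) ≡ Y i j * c
  collapse Y c = begin
    (Σ≤ i λ i₁ → Σ≤ j λ j₁ → Y i₁ j₁ * indicator 0 (i ∸ i₁) (indicator 0 (j ∸ j₁) c))
      ≡⟨ Σ≤-single i i ℕₚ.≤-refl (λ k k≤i k≢i → Σ≤-zero j λ j₁ _ →
           trans (cong (Y k j₁ *_) (indicator-other (indicator 0 (j ∸ j₁) c) (∸≢0 k≤i k≢i))) (ℚₚ.*-zeroʳ (Y k j₁))) ⟩
    (Σ≤ j λ j₁ → Y i j₁ * indicator 0 (i ∸ i) (indicator 0 (j ∸ j₁) c))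
      ≡⟨ cong (λ r → Σ≤ j λ j₁ → Y i j₁ * indicator 0 r (indicator 0 (j ∸ j₁) c)) (ℕₚ.n∸n≡0 i) ⟩
    (Σ≤ j λ j₁ → Y i j₁ * indicator 0 (j ∸ j₁) c)
      ≡⟨ Σ≤-single j j ℕₚ.≤-refl (λ k k≤j k≢j →
           trans (cong (Y i k *_) (indicator-other c (∸≢0 k≤j k≢j))) (ℚₚ.*-zeroʳ (Y i k))) ⟩
    Y i j * indicator 0 (j ∸ j) c
      ≡⟨ cong (λ r → Y i j * indicator 0 r c) (ℕₚ.n∸n≡0 j) ⟩
    Y i j * c ∎
    where open ≡-Reasoning

fromSxTy-⊛-fromST : ∀ φ h a b i j →
  (fromSxTy φ ⊛ fromST h) a b i j ≡ φ i j * shift i a (λ a′ → shift j b (h a′))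
fromSxTy-⊛-fromST φ h a b i j = trans (⊛-fromST (fromSxTy φ) h a b i j) (Σ≤-indicator₂ i j (φ i j) h a b)

-- Multiplying by a series in s, t only does not mix the coefficients of different monomials x^i y^j.
fromST-⊛-scale : ∀ {H} h → H ≋ fromST h → ∀ {X Y} c i j → (∀ a b → X a b i j ≡ c * Y a b i j) →
                 ∀ a b → (H ⊛ X) a b i j ≡ c * (H ⊛ Y) a b i j
fromST-⊛-scale {H} h H≋h {X} {Y} c i j X≡cY a b = begin
  (H ⊛ X) a b i j
    ≡⟨ 𝕊.trans (𝕊.*-comm H X) (𝕊.*-congˡ {X} H≋h) a b i j ⟩
  (X ⊛ fromST h) a b i j
    ≡⟨ ⊛-fromST X h a b i j ⟩
  (Σ≤ a λ a₁ → Σ≤ b λ b₁ → X a₁ b₁ i j * h (a ∸ a₁) (b ∸ b₁))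
    ≡⟨ (Σ≤-cong a λ a₁ → Σ≤-cong b λ b₁ →
         trans (cong (_* h (a ∸ a₁) (b ∸ b₁)) (X≡cY a₁ b₁)) (ℚₚ.*-assoc c _ _)) ⟩
  (Σ≤ a λ a₁ → Σ≤ b λ b₁ → c * (Y a₁ b₁ i j * h (a ∸ a₁) (b ∸ b₁)))
    ≡⟨ trans (*-distribˡ-Σ≤ c a _) (Σ≤-cong a λ a₁ → *-distribˡ-Σ≤ c b _) ⟨
  c * (Σ≤ a λ a₁ → Σ≤ b λ b₁ → Y a₁ b₁ i j * h (a ∸ a₁) (b ∸ b₁))
    ≡⟨ cong (c *_) (⊛-fromST Y h a b i j) ⟨
  c * (Y ⊛ fromST h) a b i j
    ≡⟨ cong (c *_) (𝕊.trans (𝕊.*-comm H Y) (𝕊.*-congˡ {Y} H≋h) a b i j) ⟨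
  c * (H ⊛ Y) a b i j ∎
  where open ≡-Reasoning

shift-fromSxTy : ∀ a i X → shift 1 a (λ a′ → shift 1 i λ i′ → indicator i′ a′ (X i′)) ≡ indicator i a (shift 1 i X)
shift-fromSxTy zero    zero    X = refl
shift-fromSxTy zero    (suc i) X = refl
shift-fromSxTy (suc a) zero    X = refl
shift-fromSxTy (suc a) (suc i) X = refl

-- The right-hand side

s+t : Series
s+t = sS ⊕ tS

-sx-ty : Series
-sx-ty = neg (sS ⊛ xS) ⊕ neg (tS ⊛ yS)

1/[1-s-t] : Series
1/[1-s-t] = geomS s+t

[-sx-ty]/[1-s-t] : Series
[-sx-ty]/[1-s-t] = -sx-ty ⊛ 1/[1-s-t]

s+t-⊛ : ∀ F a b i j → (s+t ⊛ F) a b i j ≡ shift 1 a (λ a′ → F a′ b i j) + shift 1 b (λ b′ → F a b′ i j)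
s+t-⊛ F a b i j = trans (𝕊.distribʳ F sS tS a b i j)
  (cong₂ _+_ (⊛-monomial 1 0 0 0 F a b i j) (⊛-monomial 0 1 0 0 F a b i j))

-sx-ty-⊛ : ∀ F a b i j → (-sx-ty ⊛ F) a b i j ≡
  - shift 1 a (λ a′ → shift 1 i λ i′ → F a′ b i′ j) + - shift 1 b (λ b′ → shift 1 j λ j′ → F a b′ i j′)
-sx-ty-⊛ F a b i j = trans (𝕊.distribʳ F (neg (sS ⊛ xS)) (neg (tS ⊛ yS)) a b i j) (cong₂ _+_
  (trans (neg-of-product sS xS) (cong -_ (trans (⊛-monomial 1 0 0 0 (xS ⊛ F) a b i j)
    (shift-cong 1 a λ a′ → ⊛-monomial 0 0 1 0 F a′ b i j))))
  (trans (neg-of-product tS yS) (cong -_ (trans (⊛-monomial 0 1 0 0 (yS ⊛ F) a b i j)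
    (shift-cong 1 b λ b′ → ⊛-monomial 0 0 0 1 F a b′ i j)))))
  where
  neg-of-product : ∀ X Y → (neg (X ⊛ Y) ⊛ F) a b i j ≡ - (X ⊛ (Y ⊛ F)) a b i j
  neg-of-product X Y = trans (neg-⊛ (X ⊛ Y) F a b i j) (cong -_ (𝕊.*-assoc X Y F a b i j))

1/[1-s-t]-coeff : ∀ a b i j → 1/[1-s-t] a b i j ≡ Σ≤ (a ℕ.+ b) (λ k → (s+t ^S k) a b i j)
1/[1-s-t]-coeff a b i j = Σ≤-cong (a ℕ.+ b) λ k → ℚₚ.*-identityˡ _

-- geomS truncates its sum at a + b, which is exactly what the factors at (a − 1, b) and
-- (a, b − 1) need after one factor s + t is split off.
private
  1/[1-s-t]-unfold-at : ∀ {a b} n i j → a ℕ.+ b ≡ suc n →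
                        1/[1-s-t] a b i j ≡ (oneS ⊕ (s+t ⊛ 1/[1-s-t])) a b i j
  1/[1-s-t]-unfold-at {a} {b} n i j a+b≡1+n = begin
    1/[1-s-t] a b i j
      ≡⟨ trans (1/[1-s-t]-coeff a b i j) (cong (λ r → Σ≤ r λ k → (s+t ^S k) a b i j) a+b≡1+n) ⟩
    Σ≤ (suc n) (λ k → (s+t ^S k) a b i j)
      ≡⟨ Σ≤-suc n _ ⟩
    oneS a b i j + Σ≤ n (λ k → (s+t ⊛ (s+t ^S k)) a b i j)
      ≡⟨ cong (oneS a b i j +_) (trans (Σ≤-cong n λ k → s+t-⊛ (s+t ^S k) a b i j) (Σ≤-distrib-+ n _ _)) ⟩
    oneS a b i j + (Σ≤ n (λ k → shift 1 a λ a′ → (s+t ^S k) a′ b i j)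
                    + Σ≤ n (λ k → shift 1 b λ b′ → (s+t ^S k) a b′ i j))
      ≡⟨ cong (oneS a b i j +_) (cong₂ _+_
           (trans (Σ≤-shift₁ n a λ k a′ → (s+t ^S k) a′ b i j) (along-a a a+b≡1+n))
           (trans (Σ≤-shift₁ n b λ k b′ → (s+t ^S k) a b′ i j) (along-b b a+b≡1+n))) ⟩
    oneS a b i j + (shift 1 a (λ a′ → 1/[1-s-t] a′ b i j) + shift 1 b (λ b′ → 1/[1-s-t] a b′ i j))
      ≡⟨ cong (oneS a b i j +_) (s+t-⊛ 1/[1-s-t] a b i j) ⟨
    (oneS ⊕ (s+t ⊛ 1/[1-s-t])) a b i j ∎
    where
    open ≡-Reasoning
    along-a : ∀ a → a ℕ.+ b ≡ suc n →
              shift 1 a (λ a′ → Σ≤ n λ k → (s+t ^S k) a′ b i j) ≡ shift 1 a (λ a′ → 1/[1-s-t] a′ b i j)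
    along-a zero    _  = refl
    along-a (suc a) eq = sym (trans (1/[1-s-t]-coeff a b i j) (cong (λ r → Σ≤ r _) (ℕₚ.suc-injective eq)))
    along-b : ∀ b → a ℕ.+ b ≡ suc n →
              shift 1 b (λ b′ → Σ≤ n λ k → (s+t ^S k) a b′ i j) ≡ shift 1 b (λ b′ → 1/[1-s-t] a b′ i j)
    along-b zero    _  = refl
    along-b (suc b) eq = sym (trans (1/[1-s-t]-coeff a b i j)
      (cong (λ r → Σ≤ r _) (ℕₚ.suc-injective (trans (sym (ℕₚ.+-suc a b)) eq))))

1/[1-s-t]-unfold : 1/[1-s-t] ≋ oneS ⊕ (s+t ⊛ 1/[1-s-t])
1/[1-s-t]-unfold zero    zero    i j = trans (ℚₚ.*-identityˡ (oneS 0 0 i j))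
  (sym (trans (cong (oneS 0 0 i j +_) (s+t-⊛ 1/[1-s-t] 0 0 i j)) (ℚₚ.+-identityʳ (oneS 0 0 i j))))
1/[1-s-t]-unfold (suc a) b       i j = 1/[1-s-t]-unfold-at {suc a} {b} (a ℕ.+ b) i j refl
1/[1-s-t]-unfold zero    (suc b) i j = 1/[1-s-t]-unfold-at {0} {suc b} b i j refl

1/[1-s-t]^suc-unfold : ∀ k → 1/[1-s-t] ^S suc k ≋ (1/[1-s-t] ^S k) ⊕ (s+t ⊛ (1/[1-s-t] ^S suc k))
1/[1-s-t]^suc-unfold k = begin
  1/[1-s-t] ⊛ G^k                           ≈⟨ 𝕊.*-congʳ {G^k} 1/[1-s-t]-unfold ⟩
  (oneS ⊕ (s+t ⊛ 1/[1-s-t])) ⊛ G^k          ≈⟨ 𝕊.distribʳ G^k oneS (s+t ⊛ 1/[1-s-t]) ⟩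
  (oneS ⊛ G^k) ⊕ ((s+t ⊛ 1/[1-s-t]) ⊛ G^k)  ≈⟨ 𝕊.+-cong (𝕊.*-identityˡ G^k) (𝕊.*-assoc s+t 1/[1-s-t] G^k) ⟩
  G^k ⊕ (s+t ⊛ (1/[1-s-t] ⊛ G^k))           ∎
  where
  open SetoidReasoning 𝕊.setoid
  G^k = 1/[1-s-t] ^S k

one₂ : ℕ → ℕ → ℚ
one₂ p q = indicator 0 p (indicator 0 q 1ℚ)

-- coefficient of s^p t^q in (1 + s + t)^n
trinomial : ℕ → ℕ → ℕ → ℚ
trinomial zero    p q = one₂ p q
trinomial (suc n) p q =
  trinomial n p q + (shift 1 p (λ p′ → trinomial n p′ q) + shift 1 q (λ q′ → trinomial n p q′))

trinomial-vanish : ∀ n p q → n < p ℕ.+ q → trinomial n p q ≡ 0ℚ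
trinomial-vanish zero    zero    (suc q) _ = refl
trinomial-vanish zero    (suc p) q       _ = refl
trinomial-vanish (suc n) p       q       n<p+q = cong₂ _+_
  (trinomial-vanish n p q (ℕₚ.<-trans (ℕₚ.n<1+n n) n<p+q))
  (cong₂ _+_ (lower-p p n<p+q) (lower-q q n<p+q))
  where
  lower-p : ∀ p → suc n < p ℕ.+ q → shift 1 p (λ p′ → trinomial n p′ q) ≡ 0ℚ
  lower-p zero    _              = refl
  lower-p (suc p) (s≤s n<p+q)    = trinomial-vanish n p q n<p+q
  lower-q : ∀ q → suc n < p ℕ.+ q → shift 1 q (λ q′ → trinomial n p q′) ≡ 0ℚ
  lower-q zero    _              = refl
  lower-q (suc q) 1+n<p+[1+q]    = trinomial-vanish n p q
    (ℕₚ.≤-pred (≡.subst (suc (suc n) ≤_) (ℕₚ.+-suc p q) 1+n<p+[1+q]))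

recurrence-unique : ∀ {u v c : ℕ → ℕ → ℚ} →
  (∀ a b → u a b ≡ c a b + (shift 1 a (λ a′ → u a′ b) + shift 1 b (λ b′ → u a b′))) →
  (∀ a b → v a b ≡ c a b + (shift 1 a (λ a′ → v a′ b) + shift 1 b (λ b′ → v a b′))) →
  ∀ a b → u a b ≡ v a b
recurrence-unique {u} {v} {c} u-rec v-rec = go
  where
  from-neighbours : ∀ a b → shift 1 a (λ a′ → u a′ b) ≡ shift 1 a (λ a′ → v a′ b) →
                    shift 1 b (λ b′ → u a b′) ≡ shift 1 b (λ b′ → v a b′) → u a b ≡ v a b
  from-neighbours a b ≡ₐ ≡ᵦ = trans (u-rec a b) (trans (cong (c a b +_) (cong₂ _+_ ≡ₐ ≡ᵦ)) (sym (v-rec a b)))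

  go : ∀ a b → u a b ≡ v a b
  go zero    zero    = from-neighbours 0 0 refl refl
  go (suc a) zero    = from-neighbours (suc a) 0 (go a 0) refl
  go zero    (suc b) = from-neighbours 0 (suc b) refl (go 0 b)
  go (suc a) (suc b) = from-neighbours (suc a) (suc b) (go a (suc b)) (go (suc a) b)

-- coefficient of s^a t^b in (1 − s − t)^(−k)
geomPowerCoeff : ℕ → ℕ → ℕ → ℚ
geomPowerCoeff zero    a b = one₂ a b
geomPowerCoeff (suc k) a b = trinomial (k ℕ.+ (a ℕ.+ b)) a b

private
  reindex-trinomialˢ : ∀ k a b {n} → suc n ≡ k ℕ.+ (a ℕ.+ b) →
    shift 1 a (λ a′ → trinomial n a′ b) ≡ shift 1 a (λ a′ → trinomial (k ℕ.+ (a′ ℕ.+ b)) a′ b)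
  reindex-trinomialˢ k zero    b eq = refl
  reindex-trinomialˢ k (suc a) b eq = cong (λ r → trinomial r a b) (ℕₚ.suc-injective (trans eq (ℕₚ.+-suc k (a ℕ.+ b))))

  reindex-trinomialᵗ : ∀ k a b {n} → suc n ≡ k ℕ.+ (a ℕ.+ b) →
    shift 1 b (λ b′ → trinomial n a b′) ≡ shift 1 b (λ b′ → trinomial (k ℕ.+ (a ℕ.+ b′)) a b′)
  reindex-trinomialᵗ k a zero    eq = refl
  reindex-trinomialᵗ k a (suc b) eq = cong (λ r → trinomial r a b)
    (ℕₚ.suc-injective (trans eq (trans (cong (k ℕ.+_) (ℕₚ.+-suc a b)) (ℕₚ.+-suc k (a ℕ.+ b)))))

geomPowerCoeff-rec : ∀ k a b → geomPowerCoeff (suc k) a b ≡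
  geomPowerCoeff k a b + (shift 1 a (λ a′ → geomPowerCoeff (suc k) a′ b) + shift 1 b (λ b′ → geomPowerCoeff (suc k) a b′))
geomPowerCoeff-rec zero    zero    zero    = refl
geomPowerCoeff-rec zero    (suc a) b       = cong₂ _+_
  (trinomial-vanish (a ℕ.+ b) (suc a) b (ℕₚ.n<1+n (a ℕ.+ b)))
  (cong₂ _+_ (reindex-trinomialˢ 0 (suc a) b refl) (reindex-trinomialᵗ 0 (suc a) b refl))
geomPowerCoeff-rec zero    zero    (suc b) = cong₂ _+_
  (trinomial-vanish b 0 (suc b) (ℕₚ.n<1+n b))
  (cong₂ _+_ (reindex-trinomialˢ 0 0 (suc b) refl) (reindex-trinomialᵗ 0 0 (suc b) refl))
geomPowerCoeff-rec (suc k) a       b       = cong (trinomial (k ℕ.+ (a ℕ.+ b)) a b +_)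
  (cong₂ _+_ (reindex-trinomialˢ (suc k) a b refl) (reindex-trinomialᵗ (suc k) a b refl))

fromST-recurrence : ∀ {u c} → (∀ a b → u a b ≡ c a b + (shift 1 a (λ a′ → u a′ b) + shift 1 b (λ b′ → u a b′))) →
  ∀ a b i j → fromST u a b i j ≡
              fromST c a b i j + (shift 1 a (λ a′ → fromST u a′ b i j) + shift 1 b (λ b′ → fromST u a b′ i j))
fromST-recurrence u-rec a b zero    zero    = u-rec a b
fromST-recurrence u-rec a b (suc i) j       =
  sym (cong (0ℚ +_) (cong₂ _+_ (shift-zero 1 a λ _ → refl) (shift-zero 1 b λ _ → refl)))
fromST-recurrence u-rec a b zero    (suc j) =
  sym (cong (0ℚ +_) (cong₂ _+_ (shift-zero 1 a λ _ → refl) (shift-zero 1 b λ _ → refl)))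

oneS-fromST : oneS ≋ fromST one₂
oneS-fromST zero    zero    i j = refl
oneS-fromST (suc a) b       i j = sym (trans (cong (indicator 0 i) (indicator-zero 0 j)) (indicator-zero 0 i))
oneS-fromST zero    (suc b) i j = sym (trans (cong (indicator 0 i) (indicator-zero 0 j)) (indicator-zero 0 i))

1/[1-s-t]^-coeff : ∀ k → 1/[1-s-t] ^S k ≋ fromST (geomPowerCoeff k)
1/[1-s-t]^-coeff zero            = oneS-fromST
1/[1-s-t]^-coeff (suc k) a b i j = recurrence-unique
  {u = λ a b → (1/[1-s-t] ^S suc k) a b i j} {c = λ a b → fromST (geomPowerCoeff k) a b i j}
  (λ a b → trans (1/[1-s-t]^suc-unfold k a b i j)
                 (cong₂ _+_ (1/[1-s-t]^-coeff k a b i j) (s+t-⊛ (1/[1-s-t] ^S suc k) a b i j)))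
  (λ a b → fromST-recurrence {c = geomPowerCoeff k} (geomPowerCoeff-rec k) a b i j)
  a b

-- coefficient of u^i v^j in (−u − v)^k
signedBinomial : ℕ → ℕ → ℕ → ℚ
signedBinomial zero    i j = one₂ i j
signedBinomial (suc k) i j = - shift 1 i (λ i′ → signedBinomial k i′ j) + - shift 1 j (λ j′ → signedBinomial k i j′)

signedBinomial-vanish : ∀ k i j → k ≢ i ℕ.+ j → signedBinomial k i j ≡ 0ℚ
signedBinomial-vanish zero    zero    zero    k≢i+j = ⊥-elim (k≢i+j refl)
signedBinomial-vanish zero    zero    (suc j) _     = refl
signedBinomial-vanish zero    (suc i) j       _     = refl
signedBinomial-vanish (suc k) i       j       k≢i+j = cong₂ (λ x y → - x + - y) (lower-i i k≢i+j) (lower-j j k≢i+j)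
  where
  lower-i : ∀ i → suc k ≢ i ℕ.+ j → shift 1 i (λ i′ → signedBinomial k i′ j) ≡ 0ℚ
  lower-i zero    _     = refl
  lower-i (suc i) k≢i+j = signedBinomial-vanish k i j (k≢i+j ∘ cong suc)
  lower-j : ∀ j → suc k ≢ i ℕ.+ j → shift 1 j (λ j′ → signedBinomial k i j′) ≡ 0ℚ
  lower-j zero    _     = refl
  lower-j (suc j) k≢i+j = signedBinomial-vanish k i j λ k≡i+j → k≢i+j (trans (cong suc k≡i+j) (sym (ℕₚ.+-suc i j)))

-sx-ty-⊛-fromSxTy : ∀ φ → -sx-ty ⊛ fromSxTy φ ≋
                    fromSxTy (λ i j → - shift 1 i (λ i′ → φ i′ j) + - shift 1 j (λ j′ → φ i j′))
-sx-ty-⊛-fromSxTy φ a b i j = begin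
  (-sx-ty ⊛ fromSxTy φ) a b i j
    ≡⟨ -sx-ty-⊛ (fromSxTy φ) a b i j ⟩
  - shift 1 a (λ a′ → shift 1 i λ i′ → indicator i′ a′ (indicator j b (φ i′ j)))
    + - shift 1 b (λ b′ → shift 1 j λ j′ → indicator i a (indicator j′ b′ (φ i j′)))
    ≡⟨ cong₂ (λ x y → - x + - y) along-s along-t ⟩
  - indicator i a (indicator j b (shift 1 i λ i′ → φ i′ j))
    + - indicator i a (indicator j b (shift 1 j λ j′ → φ i j′))
    ≡⟨ cong₂ _+_ (lift-neg (shift 1 i λ i′ → φ i′ j)) (lift-neg (shift 1 j λ j′ → φ i j′)) ⟨
  indicator i a (indicator j b (- shift 1 i λ i′ → φ i′ j))
    + indicator i a (indicator j b (- shift 1 j λ j′ → φ i j′))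
    ≡⟨ trans (cong (indicator i a) (indicator-+ j b _ _)) (indicator-+ i a _ _) ⟨
  fromSxTy (λ i j → - shift 1 i (λ i′ → φ i′ j) + - shift 1 j (λ j′ → φ i j′)) a b i j ∎
  where
  open ≡-Reasoning
  lift-neg : ∀ x → indicator i a (indicator j b (- x)) ≡ - indicator i a (indicator j b x)
  lift-neg x = trans (cong (indicator i a) (indicator-neg j b x)) (indicator-neg i a _)

  along-s : shift 1 a (λ a′ → shift 1 i λ i′ → indicator i′ a′ (indicator j b (φ i′ j)))
          ≡ indicator i a (indicator j b (shift 1 i λ i′ → φ i′ j))
  along-s = trans (shift-fromSxTy a i _) (cong (indicator i a) (shift-indicator j b i _))

  along-t : shift 1 b (λ b′ → shift 1 j λ j′ → indicator i a (indicator j′ b′ (φ i j′)))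
          ≡ indicator i a (indicator j b (shift 1 j λ j′ → φ i j′))
  along-t = begin
    shift 1 b (λ b′ → shift 1 j λ j′ → indicator i a (indicator j′ b′ (φ i j′)))
      ≡⟨ shift-cong 1 b (λ b′ → shift-indicator i a j _) ⟩
    shift 1 b (λ b′ → indicator i a (shift 1 j λ j′ → indicator j′ b′ (φ i j′)))
      ≡⟨ shift-indicator i a b _ ⟩
    indicator i a (shift 1 b λ b′ → shift 1 j λ j′ → indicator j′ b′ (φ i j′))
      ≡⟨ cong (indicator i a) (shift-fromSxTy b j _) ⟩
    indicator i a (indicator j b (shift 1 j λ j′ → φ i j′)) ∎

-sx-ty^-coeff : ∀ k → -sx-ty ^S k ≋ fromSxTy (signedBinomial k)
-sx-ty^-coeff zero    a b zero    zero    = refl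
-sx-ty^-coeff zero    a b (suc i) j       = trans
  (trans (cong (indicator 0 a) (indicator-zero 0 b)) (indicator-zero 0 a))
  (sym (trans (cong (indicator (suc i) a) (indicator-zero j b)) (indicator-zero (suc i) a)))
-sx-ty^-coeff zero    a b zero    (suc j) = trans
  (trans (cong (indicator 0 a) (indicator-zero 0 b)) (indicator-zero 0 a))
  (sym (trans (cong (indicator 0 a) (indicator-zero (suc j) b)) (indicator-zero 0 a)))
-sx-ty^-coeff (suc k) = 𝕊.trans (𝕊.*-congˡ { -sx-ty} (-sx-ty^-coeff k)) (-sx-ty-⊛-fromSxTy (signedBinomial k))

[-sx-ty]/[1-s-t]^-coeff : ∀ k a b i j → ([-sx-ty]/[1-s-t] ^S k) a b i j ≡
                          signedBinomial k i j * shift i a (λ a′ → shift j b (geomPowerCoeff k a′))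
[-sx-ty]/[1-s-t]^-coeff k a b i j = trans (^S-distrib-⊛ -sx-ty 1/[1-s-t] k a b i j) (trans
  (𝕊.*-cong { -sx-ty ^S k} {fromSxTy (signedBinomial k)} {1/[1-s-t] ^S k} {fromST (geomPowerCoeff k)}
            (-sx-ty^-coeff k) (1/[1-s-t]^-coeff k) a b i j)
  (fromSxTy-⊛-fromST (signedBinomial k) (geomPowerCoeff k) a b i j))

private
  product-zero : ∀ {x y} → x ≡ 0ℚ ⊎ y ≡ 0ℚ → x * y ≡ 0ℚ
  product-zero {y = y} (inj₁ refl) = ℚₚ.*-zeroˡ y
  product-zero {x = x} (inj₂ refl) = ℚₚ.*-zeroʳ x

  exp-term-vanish : ∀ k a b i j →
    signedBinomial k i j ≡ 0ℚ ⊎ shift i a (λ a′ → shift j b (geomPowerCoeff k a′)) ≡ 0ℚ →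
    inv! k * ([-sx-ty]/[1-s-t] ^S k) a b i j ≡ 0ℚ
  exp-term-vanish k a b i j factor≡0 = trans
    (cong (inv! k *_) (trans ([-sx-ty]/[1-s-t]^-coeff k a b i j) (product-zero factor≡0)))
    (ℚₚ.*-zeroʳ (inv! k))

  exp-coeff-outside : ∀ a b i j → (∀ {k} → shift i a (λ a′ → shift j b (geomPowerCoeff k a′)) ≡ 0ℚ) →
    expS [-sx-ty]/[1-s-t] a b i j ≡ inv! (i ℕ.+ j) * ([-sx-ty]/[1-s-t] ^S (i ℕ.+ j)) a b i j
  exp-coeff-outside a b i j outside = trans
    (Σ≤-zero (a ℕ.+ b) λ k _ → exp-term-vanish k a b i j (inj₂ (outside {k})))
    (sym (exp-term-vanish (i ℕ.+ j) a b i j (inj₂ (outside {i ℕ.+ j}))))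

-- (W G)^k is homogeneous of degree k in x and y, so only k = i + j contributes.
exp-coeff : ∀ a b i j →
  expS [-sx-ty]/[1-s-t] a b i j ≡ inv! (i ℕ.+ j) * ([-sx-ty]/[1-s-t] ^S (i ℕ.+ j)) a b i j
exp-coeff a b i j with i ℕₚ.≤? a | j ℕₚ.≤? b
... | yes i≤a | yes j≤b = Σ≤-single (a ℕ.+ b) (i ℕ.+ j) (ℕₚ.+-mono-≤ i≤a j≤b) λ k _ k≢i+j →
  exp-term-vanish k a b i j (inj₁ (signedBinomial-vanish k i j k≢i+j))
... | no i≰a | _      = exp-coeff-outside a b i j (shift-≰ _ i≰a)
... | yes _  | no j≰b = exp-coeff-outside a b i j (shift-zero i a λ a′ → shift-≰ _ j≰b)

rhsSeries-coeff : ∀ a b i j → rhsSeries a b i j ≡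
  inv! (i ℕ.+ j) * (signedBinomial (i ℕ.+ j) i j * shift i a (λ a′ → shift j b (geomPowerCoeff (suc (i ℕ.+ j)) a′)))
rhsSeries-coeff a b i j = begin
  (1/[1-s-t] ⊛ expS [-sx-ty]/[1-s-t]) a b i j
    ≡⟨ fromST-⊛-scale (geomPowerCoeff 1) 1/[1-s-t]-fromST {expS [-sx-ty]/[1-s-t]} {[-sx-ty]/[1-s-t] ^S K}
         (inv! K) i j (λ a b → exp-coeff a b i j) a b ⟩
  inv! K * (1/[1-s-t] ⊛ ([-sx-ty]/[1-s-t] ^S K)) a b i j
    ≡⟨ cong (inv! K *_) (regroup a b i j) ⟩
  inv! K * ((-sx-ty ^S K) ⊛ (1/[1-s-t] ^S suc K)) a b i j
    ≡⟨ cong (inv! K *_) (trans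
         (𝕊.*-cong { -sx-ty ^S K} {fromSxTy (signedBinomial K)} {1/[1-s-t] ^S suc K} {fromST (geomPowerCoeff (suc K))}
                   (-sx-ty^-coeff K) (1/[1-s-t]^-coeff (suc K)) a b i j)
         (fromSxTy-⊛-fromST (signedBinomial K) (geomPowerCoeff (suc K)) a b i j)) ⟩
  inv! K * (signedBinomial K i j * shift i a (λ a′ → shift j b (geomPowerCoeff (suc K) a′))) ∎
  where
  open ≡-Reasoning
  K = i ℕ.+ j

  1/[1-s-t]-fromST : 1/[1-s-t] ≋ fromST (geomPowerCoeff 1)
  1/[1-s-t]-fromST = 𝕊.trans (𝕊.sym (𝕊.*-identityʳ 1/[1-s-t])) (1/[1-s-t]^-coeff 1)

  regroup : 1/[1-s-t] ⊛ ([-sx-ty]/[1-s-t] ^S K) ≋ (-sx-ty ^S K) ⊛ (1/[1-s-t] ^S suc K)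
  regroup = 𝕊.trans (𝕊.*-congˡ {1/[1-s-t]} (^S-distrib-⊛ -sx-ty 1/[1-s-t] K))
                    (x∙yz≈y∙xz 1/[1-s-t] (-sx-ty ^S K) (1/[1-s-t] ^S K))
    where open CommutativeSemigroupProperties 𝕊.*-commutativeSemigroup using (x∙yz≈y∙xz)

taylor-signedBinomial : ∀ K i j → K ≡ i ℕ.+ j → taylor (signedBinomial K) i j ≡ sgn K * ℕ→ℚ (K !)
taylor-signedBinomial zero    zero zero refl    = refl
taylor-signedBinomial (suc K) i    j    1+K≡i+j = begin
  (- shift 1 i (λ i′ → signedBinomial K i′ j) + - shift 1 j (λ j′ → signedBinomial K i j′)) * (ℕ→ℚ (i !) * ℕ→ℚ (j !))
    ≡⟨ distribute (shift 1 i λ i′ → signedBinomial K i′ j) (shift 1 j λ j′ → signedBinomial K i j′) _ ⟩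
  - (shift 1 i (λ i′ → signedBinomial K i′ j) * (ℕ→ℚ (i !) * ℕ→ℚ (j !)))
    + - (shift 1 j (λ j′ → signedBinomial K i j′) * (ℕ→ℚ (i !) * ℕ→ℚ (j !)))
    ≡⟨ cong₂ (λ x y → - x + - y) (lower-i i 1+K≡i+j) (lower-j j 1+K≡i+j) ⟩
  - (ℕ→ℚ i * (sgn K * ℕ→ℚ (K !))) + - (ℕ→ℚ j * (sgn K * ℕ→ℚ (K !)))
    ≡⟨ collect (ℕ→ℚ i) (ℕ→ℚ j) (sgn K) (ℕ→ℚ (K !)) ⟩
  - sgn K * ((ℕ→ℚ i + ℕ→ℚ j) * ℕ→ℚ (K !))
    ≡⟨ cong (λ x → - sgn K * (x * ℕ→ℚ (K !))) (trans (sym (ℕ→ℚ-+ i j)) (cong ℕ→ℚ (sym 1+K≡i+j))) ⟩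
  - sgn K * (ℕ→ℚ (suc K) * ℕ→ℚ (K !))
    ≡⟨ cong (- sgn K *_) (ℕ→ℚ-* (suc K) (K !)) ⟨
  - sgn K * ℕ→ℚ (suc K !) ∎
  where
  open ≡-Reasoning
  distribute : ∀ x y z → (- x + - y) * z ≡ - (x * z) + - (y * z)
  distribute = solve-∀ ℚ-ring
  collect : ∀ x y σ f → - (x * (σ * f)) + - (y * (σ * f)) ≡ - σ * ((x + y) * f)
  collect = solve-∀ ℚ-ring
  pull-outˡ : ∀ x a I J → x * (a * I * J) ≡ a * (x * (I * J))
  pull-outˡ = solve-∀ ℚ-ring
  pull-outʳ : ∀ x a I J → x * (I * (a * J)) ≡ a * (x * (I * J))
  pull-outʳ = solve-∀ ℚ-ring

  lower-i : ∀ i → suc K ≡ i ℕ.+ j →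
    shift 1 i (λ i′ → signedBinomial K i′ j) * (ℕ→ℚ (i !) * ℕ→ℚ (j !)) ≡ ℕ→ℚ i * (sgn K * ℕ→ℚ (K !))
  lower-i zero    _         = trans (ℚₚ.*-zeroˡ (ℕ→ℚ 1 * ℕ→ℚ (j !))) (sym (ℚₚ.*-zeroˡ (sgn K * ℕ→ℚ (K !))))
  lower-i (suc i) 1+K≡1+i+j = trans
    (cong (λ x → signedBinomial K i j * (x * ℕ→ℚ (j !))) (ℕ→ℚ-* (suc i) (i !)))
    (trans (pull-outˡ (signedBinomial K i j) (ℕ→ℚ (suc i)) (ℕ→ℚ (i !)) (ℕ→ℚ (j !)))
           (cong (ℕ→ℚ (suc i) *_) (taylor-signedBinomial K i j (ℕₚ.suc-injective 1+K≡1+i+j))))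

  lower-j : ∀ j → suc K ≡ i ℕ.+ j →
    shift 1 j (λ j′ → signedBinomial K i j′) * (ℕ→ℚ (i !) * ℕ→ℚ (j !)) ≡ ℕ→ℚ j * (sgn K * ℕ→ℚ (K !))
  lower-j zero    _         = trans (ℚₚ.*-zeroˡ (ℕ→ℚ (i !) * ℕ→ℚ 1)) (sym (ℚₚ.*-zeroˡ (sgn K * ℕ→ℚ (K !))))
  lower-j (suc j) 1+K≡i+1+j = trans
    (cong (λ x → signedBinomial K i j * (ℕ→ℚ (i !) * x)) (ℕ→ℚ-* (suc j) (j !)))
    (trans (pull-outʳ (signedBinomial K i j) (ℕ→ℚ (suc j)) (ℕ→ℚ (i !)) (ℕ→ℚ (j !)))
           (cong (ℕ→ℚ (suc j) *_) (taylor-signedBinomial K i j (ℕₚ.suc-injective (trans 1+K≡i+1+j (ℕₚ.+-suc i j))))))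

-- The left-hand side

D+ : ℚ → Poly → Poly
D+ c p i j = c * p i j + Dpoly p i j

iterate-DExp : ∀ k c p → iterate k DExp (p ·e^[ c ]) ≡ (iterate k (D+ (c + c)) p ·e^[ c ])
iterate-DExp zero    c p = refl
iterate-DExp (suc k) c p = cong DExp (iterate-DExp k c p)

-- The weight of e^(−(x+y)/2) contributes − ½ + − ½, which evaluates to − 1ℚ.
L-as-iterate : ∀ n m i j → L n m i j ≡ iterate (n ℕ.+ m) (D+ (- 1ℚ)) (mono n m) i j
L-as-iterate n m i j = cong (λ e → poly (mulExp ½ e) i j) (iterate-DExp (n ℕ.+ m) (- ½) (mono n m))

VanishesAbove : ℕ → ℕ → Poly → Set
VanishesAbove n m p = ∀ i j → n < i ⊎ m < j → p i j ≡ 0ℚ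

mono-vanishesAbove : ∀ n m → VanishesAbove n m (mono n m)
mono-vanishesAbove n m i j (inj₁ n<i) = indicator-other _ (ℕₚ.>⇒≢ n<i)
mono-vanishesAbove n m i j (inj₂ m<j) =
  trans (cong (indicator n i) (indicator-other 1ℚ (ℕₚ.>⇒≢ m<j))) (indicator-zero n i)

D+-vanishesAbove : ∀ c {n m p} → VanishesAbove n m p → VanishesAbove n m (D+ c p)
D+-vanishesAbove c {p = p} p-vanishes i j outside = trans
  (cong₂ (λ x y → c * x + y) (p-vanishes i j outside) (cong₂ _+_
    (cong (ℕ→ℚ (suc i) *_) (p-vanishes (suc i) j (Sum.map₁ ℕₚ.m<n⇒m<1+n outside)))
    (cong (ℕ→ℚ (suc j) *_) (p-vanishes i (suc j) (Sum.map₂ ℕₚ.m<n⇒m<1+n outside)))))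
  (annihilate c (ℕ→ℚ (suc i)) (ℕ→ℚ (suc j)))
  where
  annihilate : ∀ x y z → x * 0ℚ + (y * 0ℚ + z * 0ℚ) ≡ 0ℚ
  annihilate = solve-∀ ℚ-ring

iterate-vanishesAbove : ∀ c k {n m p} → VanishesAbove n m p → VanishesAbove n m (iterate k (D+ c) p)
iterate-vanishesAbove c zero    p-vanishes = p-vanishes
iterate-vanishesAbove c (suc k) p-vanishes = D+-vanishesAbove c (iterate-vanishesAbove c k p-vanishes)

taylor-D+ : ∀ c p i j → taylor (D+ c p) i j ≡ c * taylor p i j + (taylor p (suc i) j + taylor p i (suc j))
taylor-D+ c p i j = trans
  (rearrange c (p i j) (p (suc i) j) (p i (suc j)) (ℕ→ℚ (suc i)) (ℕ→ℚ (suc j)) (ℕ→ℚ (i !)) (ℕ→ℚ (j !)))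
  (sym (cong₂ (λ x y → c * taylor p i j + (p (suc i) j * (x * ℕ→ℚ (j !)) + p i (suc j) * (ℕ→ℚ (i !) * y)))
              (ℕ→ℚ-* (suc i) (i !)) (ℕ→ℚ-* (suc j) (j !))))
  where
  rearrange : ∀ c x y z a b I J → (c * x + (a * y + b * z)) * (I * J) ≡
                                  c * (x * (I * J)) + (y * ((a * I) * J) + z * (I * (b * J)))
  rearrange = solve-∀ ℚ-ring

-- coefficient of s^p t^q in (−1 + s + t)^k
signedTrinomial : ℕ → ℕ → ℕ → ℚ
signedTrinomial k p q = sgn (k ℕ.+ (p ℕ.+ q)) * trinomial k p q

signedTrinomial-suc : ∀ k p q → signedTrinomial (suc k) p q ≡
  - signedTrinomial k p q + (shift 1 p (λ p′ → signedTrinomial k p′ q) + shift 1 q (λ q′ → signedTrinomial k p q′))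
signedTrinomial-suc k p q = trans
  (distribute (sgn (k ℕ.+ (p ℕ.+ q))) (trinomial k p q) _ _)
  (cong (- signedTrinomial k p q +_) (sym (cong₂ _+_ (lower-p p) (lower-q q))))
  where
  distribute : ∀ σ x y z → - σ * (x + (y + z)) ≡ - (σ * x) + (- σ * y + - σ * z)
  distribute = solve-∀ ℚ-ring

  flip-twice : ∀ r x → sgn r * x ≡ - sgn (suc r) * x
  flip-twice r x = cong (_* x) (sym (⁻¹-involutive (sgn r)))

  lower-p : ∀ p → shift 1 p (λ p′ → signedTrinomial k p′ q) ≡
                  - sgn (k ℕ.+ (p ℕ.+ q)) * shift 1 p (λ p′ → trinomial k p′ q)
  lower-p zero    = sym (ℚₚ.*-zeroʳ (- sgn (k ℕ.+ q)))
  lower-p (suc p) = trans (flip-twice (k ℕ.+ (p ℕ.+ q)) (trinomial k p q))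
    (cong (λ r → - sgn r * trinomial k p q) (sym (ℕₚ.+-suc k (p ℕ.+ q))))

  lower-q : ∀ q → shift 1 q (λ q′ → signedTrinomial k p q′) ≡
                  - sgn (k ℕ.+ (p ℕ.+ q)) * shift 1 q (λ q′ → trinomial k p q′)
  lower-q zero    = sym (ℚₚ.*-zeroʳ (- sgn (k ℕ.+ (p ℕ.+ 0))))
  lower-q (suc q) = trans (flip-twice (k ℕ.+ (p ℕ.+ q)) (trinomial k p q))
    (cong (λ r → - sgn r * trinomial k p q) (sym (trans (cong (k ℕ.+_) (ℕₚ.+-suc p q)) (ℕₚ.+-suc k (p ℕ.+ q)))))

taylor-mono : ∀ {n m} i p j q → n ≡ i ℕ.+ p → m ≡ j ℕ.+ q →
  taylor (mono n m) i j ≡ signedTrinomial 0 p q * (ℕ→ℚ (n !) * ℕ→ℚ (m !))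
taylor-mono {n} {m} i zero j zero n≡i+0 m≡j+0
  with trans n≡i+0 (ℕₚ.+-identityʳ i) | trans m≡j+0 (ℕₚ.+-identityʳ j)
... | refl | refl = trans
  (cong (_* (ℕ→ℚ (n !) * ℕ→ℚ (m !))) (trans (cong (indicator n n) (indicator-self m 1ℚ)) (indicator-self n 1ℚ)))
  (cong (_* (ℕ→ℚ (n !) * ℕ→ℚ (m !))) (sym (ℚₚ.*-identityˡ 1ℚ)))
taylor-mono {n} {m} i (suc p) j q n≡i+1+p _ = trans
  (cong (_* _) (indicator-other _ (ℕₚ.<⇒≢ (≡.subst (i <_) (sym n≡i+1+p) (ℕₚ.m<m+n i (s≤s z≤n))))))
  (trans (ℚₚ.*-zeroˡ (ℕ→ℚ (i !) * ℕ→ℚ (j !)))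
         (sym (trans (cong (_* (ℕ→ℚ (n !) * ℕ→ℚ (m !))) (ℚₚ.*-zeroʳ (- sgn (p ℕ.+ q))))
                     (ℚₚ.*-zeroˡ (ℕ→ℚ (n !) * ℕ→ℚ (m !))))))
taylor-mono {n} {m} i zero j (suc q) _ m≡j+1+q = trans
  (cong (_* _) (trans (cong (indicator n i)
                        (indicator-other 1ℚ (ℕₚ.<⇒≢ (≡.subst (j <_) (sym m≡j+1+q) (ℕₚ.m<m+n j (s≤s z≤n))))))
                      (indicator-zero n i)))
  (trans (ℚₚ.*-zeroˡ (ℕ→ℚ (i !) * ℕ→ℚ (j !)))
         (sym (trans (cong (_* (ℕ→ℚ (n !) * ℕ→ℚ (m !))) (ℚₚ.*-zeroʳ (- sgn q)))
                     (ℚₚ.*-zeroˡ (ℕ→ℚ (n !) * ℕ→ℚ (m !))))))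

taylor-iterate : ∀ {n m} k i p j q → n ≡ i ℕ.+ p → m ≡ j ℕ.+ q →
  taylor (iterate k (D+ (- 1ℚ)) (mono n m)) i j ≡ signedTrinomial k p q * (ℕ→ℚ (n !) * ℕ→ℚ (m !))
taylor-iterate zero    = taylor-mono
taylor-iterate {n} {m} (suc k) i p j q n≡i+p m≡j+q = begin
  taylor (D+ (- 1ℚ) (T k)) i j
    ≡⟨ taylor-D+ (- 1ℚ) (T k) i j ⟩
  - 1ℚ * taylor (T k) i j + (taylor (T k) (suc i) j + taylor (T k) i (suc j))
    ≡⟨ cong₂ (λ x y → - 1ℚ * x + y) (taylor-iterate k i p j q n≡i+p m≡j+q)
             (cong₂ _+_ (neighbour-i p n≡i+p) (neighbour-j q m≡j+q)) ⟩
  - 1ℚ * (signedTrinomial k p q * N!M!)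
    + (shift 1 p (λ p′ → signedTrinomial k p′ q) * N!M! + shift 1 q (λ q′ → signedTrinomial k p q′) * N!M!)
    ≡⟨ collect (signedTrinomial k p q) (shift 1 p λ p′ → signedTrinomial k p′ q)
               (shift 1 q λ q′ → signedTrinomial k p q′) N!M! ⟩
  (- signedTrinomial k p q + (shift 1 p (λ p′ → signedTrinomial k p′ q) + shift 1 q (λ q′ → signedTrinomial k p q′))) * N!M!
    ≡⟨ cong (_* N!M!) (signedTrinomial-suc k p q) ⟨
  signedTrinomial (suc k) p q * N!M! ∎
  where
  open ≡-Reasoning
  N!M! = ℕ→ℚ (n !) * ℕ→ℚ (m !)

  T : ℕ → Poly
  T k = iterate k (D+ (- 1ℚ)) (mono n m)

  collect : ∀ x y z w → - 1ℚ * (x * w) + (y * w + z * w) ≡ (- x + (y + z)) * w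
  collect = solve-∀ ℚ-ring

  T-vanishes : VanishesAbove n m (T k)
  T-vanishes = iterate-vanishesAbove (- 1ℚ) k (mono-vanishesAbove n m)

  neighbour-i : ∀ p → n ≡ i ℕ.+ p → taylor (T k) (suc i) j ≡ shift 1 p (λ p′ → signedTrinomial k p′ q) * N!M!
  neighbour-i zero    n≡i+0   = trans
    (cong (_* _) (T-vanishes (suc i) j (inj₁ (≡.subst (_< suc i) (sym (trans n≡i+0 (ℕₚ.+-identityʳ i))) (ℕₚ.n<1+n i)))))
    (trans (ℚₚ.*-zeroˡ (ℕ→ℚ (suc i !) * ℕ→ℚ (j !))) (sym (ℚₚ.*-zeroˡ N!M!)))
  neighbour-i (suc p) n≡i+1+p = taylor-iterate k (suc i) p j q (trans n≡i+1+p (ℕₚ.+-suc i p)) m≡j+q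

  neighbour-j : ∀ q → m ≡ j ℕ.+ q → taylor (T k) i (suc j) ≡ shift 1 q (λ q′ → signedTrinomial k p q′) * N!M!
  neighbour-j zero    m≡j+0   = trans
    (cong (_* _) (T-vanishes i (suc j) (inj₂ (≡.subst (_< suc j) (sym (trans m≡j+0 (ℕₚ.+-identityʳ j))) (ℕₚ.n<1+n j)))))
    (trans (ℚₚ.*-zeroˡ (ℕ→ℚ (i !) * ℕ→ℚ (suc j !))) (sym (ℚₚ.*-zeroˡ N!M!)))
  neighbour-j (suc q) m≡j+1+q = taylor-iterate k i p (suc j) q n≡i+p (trans m≡j+1+q (ℕₚ.+-suc j q))

-- Comparison of coefficients

taylor-lhsSeries : ∀ i p j q → taylor (lhsSeries (i ℕ.+ p) (j ℕ.+ q)) i j ≡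
                               sgn (i ℕ.+ j) * geomPowerCoeff (suc (i ℕ.+ j)) p q
taylor-lhsSeries i p j q = begin
  L n m i j * inv! n * inv! m * (ℕ→ℚ (i !) * ℕ→ℚ (j !))
    ≡⟨ regroup (L n m i j) (inv! n) (inv! m) (ℕ→ℚ (i !) * ℕ→ℚ (j !)) ⟩
  taylor (L n m) i j * (inv! n * inv! m)
    ≡⟨ cong (λ x → x * (ℕ→ℚ (i !) * ℕ→ℚ (j !)) * (inv! n * inv! m)) (L-as-iterate n m i j) ⟩
  taylor (iterate (n ℕ.+ m) (D+ (- 1ℚ)) (mono n m)) i j * (inv! n * inv! m)
    ≡⟨ cong (_* (inv! n * inv! m)) (taylor-iterate (n ℕ.+ m) i p j q refl refl) ⟩
  signedTrinomial (n ℕ.+ m) p q * (ℕ→ℚ (n !) * ℕ→ℚ (m !)) * (inv! n * inv! m)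
    ≡⟨ pair-up (signedTrinomial (n ℕ.+ m) p q) (ℕ→ℚ (n !)) (ℕ→ℚ (m !)) (inv! n) (inv! m) ⟩
  signedTrinomial (n ℕ.+ m) p q * ((inv! n * ℕ→ℚ (n !)) * (inv! m * ℕ→ℚ (m !)))
    ≡⟨ cong₂ (λ u v → signedTrinomial (n ℕ.+ m) p q * (u * v)) (inv!-inverse n) (inv!-inverse m) ⟩
  signedTrinomial (n ℕ.+ m) p q * (1ℚ * 1ℚ)
    ≡⟨ trans (cong (signedTrinomial (n ℕ.+ m) p q *_) (ℚₚ.*-identityˡ 1ℚ)) (ℚₚ.*-identityʳ _) ⟩
  signedTrinomial (n ℕ.+ m) p q
    ≡⟨ cong (λ k → signedTrinomial k p q) (interchange i p j q) ⟩
  sgn (K ℕ.+ r ℕ.+ r) * trinomial (K ℕ.+ r) p q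
    ≡⟨ cong (_* trinomial (K ℕ.+ r) p q) (trans (cong sgn (ℕₚ.+-assoc K r r)) (sgn-+-double K r)) ⟩
  sgn K * geomPowerCoeff (suc K) p q ∎
  where
  open ≡-Reasoning
  open CommutativeSemigroupProperties ℕₚ.+-commutativeSemigroup using (interchange)
  n = i ℕ.+ p
  m = j ℕ.+ q
  K = i ℕ.+ j
  r = p ℕ.+ q
  regroup : ∀ x a b F → x * a * b * F ≡ x * F * (a * b)
  regroup = solve-∀ ℚ-ring
  pair-up : ∀ x N M a b → x * (N * M) * (a * b) ≡ x * ((a * N) * (b * M))
  pair-up = solve-∀ ℚ-ring

taylor-rhsSeries : ∀ i p j q → taylor (rhsSeries (i ℕ.+ p) (j ℕ.+ q)) i j ≡
                               sgn (i ℕ.+ j) * geomPowerCoeff (suc (i ℕ.+ j)) p q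
taylor-rhsSeries i p j q = begin
  rhsSeries (i ℕ.+ p) (j ℕ.+ q) i j * (ℕ→ℚ (i !) * ℕ→ℚ (j !))
    ≡⟨ cong (_* (ℕ→ℚ (i !) * ℕ→ℚ (j !))) (trans (rhsSeries-coeff (i ℕ.+ p) (j ℕ.+ q) i j)
         (cong (λ x → inv! K * (signedBinomial K i j * x))
               (trans (shift-+ i p _) (shift-+ j q (geomPowerCoeff (suc K) p))))) ⟩
  inv! K * (signedBinomial K i j * g) * (ℕ→ℚ (i !) * ℕ→ℚ (j !))
    ≡⟨ move-in (inv! K) (signedBinomial K i j) g (ℕ→ℚ (i !) * ℕ→ℚ (j !)) ⟩
  inv! K * (signedBinomial K i j * (ℕ→ℚ (i !) * ℕ→ℚ (j !))) * g
    ≡⟨ cong (λ x → inv! K * x * g) (taylor-signedBinomial K i j refl) ⟩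
  inv! K * (sgn K * ℕ→ℚ (K !)) * g
    ≡⟨ move-out (inv! K) (sgn K) (ℕ→ℚ (K !)) g ⟩
  sgn K * g * (inv! K * ℕ→ℚ (K !))
    ≡⟨ trans (cong (sgn K * g *_) (inv!-inverse K)) (ℚₚ.*-identityʳ _) ⟩
  sgn K * g ∎
  where
  open ≡-Reasoning
  K = i ℕ.+ j
  g = geomPowerCoeff (suc K) p q
  move-in : ∀ c x g F → c * (x * g) * F ≡ c * (x * F) * g
  move-in = solve-∀ ℚ-ring
  move-out : ∀ c σ f g → c * (σ * f) * g ≡ σ * g * (c * f)
  move-out = solve-∀ ℚ-ring

factorials-invertible : ∀ i j → (ℕ→ℚ (i !) * ℕ→ℚ (j !)) * (inv! i * inv! j) ≡ 1ℚ
factorials-invertible i j = trans (pair-up (ℕ→ℚ (i !)) (ℕ→ℚ (j !)) (inv! i) (inv! j))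
  (trans (cong₂ _*_ (inv!-inverse i) (inv!-inverse j)) (ℚₚ.*-identityˡ 1ℚ))
  where
  pair-up : ∀ I J a b → (I * J) * (a * b) ≡ (a * I) * (b * J)
  pair-up = solve-∀ ℚ-ring

*-cancelʳ-invertible : ∀ {x y z} w → z * w ≡ 1ℚ → x * z ≡ y * z → x ≡ y
*-cancelʳ-invertible {x} {y} {z} w zw≡1 xz≡yz = begin
  x              ≡⟨ ℚₚ.*-identityʳ x ⟨
  x * 1ℚ         ≡⟨ cong (x *_) zw≡1 ⟨
  x * (z * w)    ≡⟨ ℚₚ.*-assoc x z w ⟨
  x * z * w      ≡⟨ cong (_* w) xz≡yz ⟩
  y * z * w      ≡⟨ ℚₚ.*-assoc y z w ⟩
  y * (z * w)    ≡⟨ cong (y *_) zw≡1 ⟩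
  y * 1ℚ         ≡⟨ ℚₚ.*-identityʳ y ⟩
  y              ∎
  where open ≡-Reasoning

lhsSeries-vanish : ∀ a b i j → a < i ⊎ b < j → lhsSeries a b i j ≡ 0ℚ
lhsSeries-vanish a b i j outside = trans
  (cong (λ x → x * inv! a * inv! b) (trans (L-as-iterate a b i j)
    (iterate-vanishesAbove (- 1ℚ) (a ℕ.+ b) (mono-vanishesAbove a b) i j outside)))
  (trans (cong (_* inv! b) (ℚₚ.*-zeroˡ (inv! a))) (ℚₚ.*-zeroˡ (inv! b)))

rhsSeries-vanish : ∀ a b i j → ¬ i ≤ a ⊎ ¬ j ≤ b → rhsSeries a b i j ≡ 0ℚ
rhsSeries-vanish a b i j outside = trans (rhsSeries-coeff a b i j)
  (product-zero {inv! (i ℕ.+ j)} (inj₂ (product-zero {signedBinomial (i ℕ.+ j) i j} (inj₂ (no-shift outside)))))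
  where
  no-shift : ¬ i ≤ a ⊎ ¬ j ≤ b → shift i a (λ a′ → shift j b (geomPowerCoeff (suc (i ℕ.+ j)) a′)) ≡ 0ℚ
  no-shift (inj₁ i≰a) = shift-≰ _ i≰a
  no-shift (inj₂ j≰b) = shift-zero i a λ a′ → shift-≰ _ j≰b

corollary1 : ∀ (a b i j : ℕ) → lhsSeries a b i j ≡ rhsSeries a b i j
corollary1 a b i j with i ℕₚ.≤? a | j ℕₚ.≤? b
... | yes i≤a | yes j≤b = ≡.subst₂ (λ a b → lhsSeries a b i j ≡ rhsSeries a b i j)
  (ℕₚ.m+[n∸m]≡n i≤a) (ℕₚ.m+[n∸m]≡n j≤b)
  (*-cancelʳ-invertible (inv! i * inv! j) (factorials-invertible i j)
    (trans (taylor-lhsSeries i (a ∸ i) j (b ∸ j)) (sym (taylor-rhsSeries i (a ∸ i) j (b ∸ j)))))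
... | no i≰a | _      =
  trans (lhsSeries-vanish a b i j (inj₁ (ℕₚ.≰⇒> i≰a))) (sym (rhsSeries-vanish a b i j (inj₁ i≰a)))
... | yes _  | no j≰b =
  trans (lhsSeries-vanish a b i j (inj₂ (ℕₚ.≰⇒> j≰b))) (sym (rhsSeries-vanish a b i j (inj₂ j≰b)))
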